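{- Let $\overline{(\cdot)}$ be the CGPS translation from $\lambda H\mathbf{J}^{\mathbf{mse}}$ to $\underline{\lambda}H$ (and, by restriction, from $\lambda\omega\mathbf{J}^{\mathbf{mse}}$ to $\underline{\lambda}\omega$) described in the context. If $t\rightarrow u$ in $\lambda H\mathbf{J}^{\mathbf{mse}}$ (resp. $\lambda\omega\mathbf{J}^{\mathbf{mse}}$), then $\overline{t}\rightarrow^+\overline{u}$ in $\underline{\lambda}H$ (resp. $\underline{\lambda}\omega$).
   Context: Domains $\mathcal{D},\mathcal{E}::=PROP\mid\mathsf{X}\mid\mathcal{D}\to\mathcal{E}$ ($\mathsf{X}$ domain variables). Inhabitants $A,B::=X\mid\leftthreetimes X.A\mid AB\mid A\supset B\mid\forall X:\mathcal{D}.A$, with reduction $(\beta_0)\ (\leftthreetimes X.A)B\rightarrow[B/X]A$ (in any subexpression). In $\lambda\omega\mathbf{J}^{\mathbf{mse}}$ and $\underline{\lambda}\omega$ domain variables $\mathsf{X}$ are not allowed; otherwise these systems coincide with $\lambda H\mathbf{J}^{\mathbf{mse}}$ and $\underline{\lambda}H$ respectively. $\lambda H\mathbf{J}^{\mathbf{mse}}$ proof expressions: terms $t,u::=x\mid\lambda x.t\mid\Lambda X.t\mid\{c\}$; co-terms $l::=[]\mid u::l\mid B::l\mid(x)c$; commands $c::=t\,l$. Evaluation contexts $E::=[]\mid u::l\mid B::l$; for $U$ a term or inhabitant, $[]@l'=l'$, $(U::l)@l'=U::(l@l')$, $((x)t\,l)@l'=(x)t(l@l')$. Reduction: closure under all constructors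 of $(\beta_1)\ (\lambda x.t)(u::l)\rightarrow u((x)t\,l)$; $(\beta_2)\ (\Lambda X.t)(B::l)\rightarrow([B/X]t)\,l$; $(\pi)\ \{t\,l\}E\rightarrow t(l@E)$; $(\sigma)\ t(x)c\rightarrow[t/x]c$; $(\mu)\ (x)x\,l\rightarrow l$ if $x\notin l$; $(\epsilon)\ \{t[]\}\rightarrow t$; plus $B::l\rightarrow B'::l$ whenever $B\rightarrow_{\beta_0}B'$. $\underline{\lambda}H$ proof terms $t::=x\mid\lambda x.t\mid tu\mid\Lambda X.t\mid tA$, with reduction the compatible closure of $(\lambda x.t)u\rightarrow[u/x]t$, $(\Lambda X.t)B\rightarrow[B/X]t$, and $tB\rightarrow tB'$ whenever $B\rightarrow_{\beta_0}B'$; $\rightarrow^+$ denotes one or more such steps. Translation: $\bot$ fixed propositional variable, $\neg A=A\supset\bot$, $\top$ a fixed proposition and $\mathsf{s}$ a closed proof term of $\top\supset\top$ with $\mathsf{s}\,G\rightarrow^+G$ for all $G$ (e.g. $\lambda z.z$), $G^+=\mathsf{s}G$, $[t;u]=(\lambda y.t)u$ with $y\notin t$. Inhabitants: $X^*=X$, $(A\supset B)^*=\neg\overline{B}\supset\neg\overline{A}$, $(\forall X:\mathcal{D}.A)^*=\forall X:\mathcal{D}.\overline{A}$, $(\leftthreetimes X.A)^*=\leftthreetimes X.A^*$, $(AB)^*=A^*B^*$, $\overline{A}=\top\supset\neg\neg A^*$. Proof expressions ($w,m$ fresh): $(x:G,K)=x\,G^+K$; $(\lambda x.t:G,K)=[K(\lambda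 wx.w\,\overline{t});G]$; $(\Lambda X.t:G,K)=[K(\Lambda X.\overline{t});G]$; $(\{c\}:G,K)=(c:G^+,K)$; $([]:G,K)=\lambda w.wGK$; $(u::l:G,K)=\lambda w.wG(\lambda m.m\,(l:G,K)\,\overline{u})$; $(B::l:G,K)=\lambda w.wG(\lambda m.(l:G,K)(mB^*))$; $((x)c:G,K)=\lambda x.(c:G,K)$; $(t[]:G,K)=(t:G,K)$; $(t(u::l):G,K)=(t:G,\lambda m.m\,(l:G,K)\,\overline{u})$; $(t(B::l):G,K)=(t:G,\lambda m.(l:G,K)(mB^*))$; $(t(x)c:G,K)=((x)c:G,K)\,\overline{t}$; $\overline{t}=\lambda gk.(t:g,k)$ with $g,k$ fresh. -}

module Defs where

open import Data.Nat using (ℕ; zero; suc; _+_; _<_)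
open import Data.Unit using (⊤)
open import Data.Empty using (⊥)
open import Data.Product using (_×_)
open import Relation.Binary.Construct.Closure.Transitive using (TransClosure)

-- Representation conventions:
--  * proof variables and inhabitant variables are de Bruijn indices
--    (two separate index spaces); binders: lam / (x)c / ƛ bind proof
--    variables, Lam / Λ / ⋋ / ∀ bind inhabitant variables.
--  * domain variables are free atoms (no binder for them exists).

data Dom : Set where
  PROP : Dom
  dvar : ℕ → Dom
  _⇒_  : Dom → Dom → Dom

infixr 6 _⊃_
data Inh : Set where
  ivar : ℕ → Inh
  ilam : Inh → Inh
  iapp : Inh → Inh → Inh
  _⊃_  : Inh → Inh → Inh
  iall : Dom → Inh → Inh

extR : (ℕ → ℕ) → ℕ → ℕ
extR ρ zero    = zero
extR ρ (suc i) = suc (ρ i)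

renI : (ℕ → ℕ) → Inh → Inh
renI ρ (ivar i)   = ivar (ρ i)
renI ρ (ilam A)   = ilam (renI (extR ρ) A)
renI ρ (iapp A B) = iapp (renI ρ A) (renI ρ B)
renI ρ (A ⊃ B)    = renI ρ A ⊃ renI ρ B
renI ρ (iall D A) = iall D (renI (extR ρ) A)

extSI : (ℕ → Inh) → ℕ → Inh
extSI σ zero    = ivar zero
extSI σ (suc i) = renI suc (σ i)

subI : (ℕ → Inh) → Inh → Inh
subI σ (ivar i)   = σ i
subI σ (ilam A)   = ilam (subI (extSI σ) A)
subI σ (iapp A B) = iapp (subI σ A) (subI σ B)
subI σ (A ⊃ B)    = subI σ A ⊃ subI σ B
subI σ (iall D A) = iall D (subI (extSI σ) A)

_•I : Inh → ℕ → Inh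
(B •I) zero    = B
(B •I) (suc i) = ivar i

infix 4 _⟶₀_
data _⟶₀_ : Inh → Inh → Set where
  β₀    : ∀ {A B} → iapp (ilam A) B ⟶₀ subI (B •I) A
  ilamξ : ∀ {A A'} → A ⟶₀ A' → ilam A ⟶₀ ilam A'
  iappl : ∀ {A A' B} → A ⟶₀ A' → iapp A B ⟶₀ iapp A' B
  iappr : ∀ {A B B'} → B ⟶₀ B' → iapp A B ⟶₀ iapp A B'
  impl  : ∀ {A A' B} → A ⟶₀ A' → (A ⊃ B) ⟶₀ (A' ⊃ B)
  impr  : ∀ {A B B'} → B ⟶₀ B' → (A ⊃ B) ⟶₀ (A ⊃ B')
  iallξ : ∀ {D A A'} → A ⟶₀ A' → iall D A ⟶₀ iall D A'

mutual
  data Tm : Set where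
    var : ℕ → Tm
    lam : Tm → Tm
    Lam : Tm → Tm
    br  : Cmd → Tm

  data CoTm : Set where
    nil  : CoTm
    cons : Tm → CoTm → CoTm
    icns : Inh → CoTm → CoTm
    mu   : Cmd → CoTm

  data Cmd : Set where
    cut : Tm → CoTm → Cmd

mutual
  renTm : (ℕ → ℕ) → Tm → Tm
  renTm ρ (var x) = var (ρ x)
  renTm ρ (lam t) = lam (renTm (extR ρ) t)
  renTm ρ (Lam t) = Lam (renTm ρ t)
  renTm ρ (br c)  = br (renCmd ρ c)

  renCo : (ℕ → ℕ) → CoTm → CoTm
  renCo ρ nil        = nil
  renCo ρ (cons u l) = cons (renTm ρ u) (renCo ρ l)
  renCo ρ (icns B l) = icns B (renCo ρ l)
  renCo ρ (mu c)     = mu (renCmd (extR ρ) c)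

  renCmd : (ℕ → ℕ) → Cmd → Cmd
  renCmd ρ (cut t l) = cut (renTm ρ t) (renCo ρ l)

mutual
  renITm : (ℕ → ℕ) → Tm → Tm
  renITm ρ (var x) = var x
  renITm ρ (lam t) = lam (renITm ρ t)
  renITm ρ (Lam t) = Lam (renITm (extR ρ) t)
  renITm ρ (br c)  = br (renICmd ρ c)

  renICo : (ℕ → ℕ) → CoTm → CoTm
  renICo ρ nil        = nil
  renICo ρ (cons u l) = cons (renITm ρ u) (renICo ρ l)
  renICo ρ (icns B l) = icns (renI ρ B) (renICo ρ l)
  renICo ρ (mu c)     = mu (renICmd ρ c)

  renICmd : (ℕ → ℕ) → Cmd → Cmd
  renICmd ρ (cut t l) = cut (renITm ρ t) (renICo ρ l)

mutual
  subITm : (ℕ → Inh) → Tm → Tm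
  subITm σ (var x) = var x
  subITm σ (lam t) = lam (subITm σ t)
  subITm σ (Lam t) = Lam (subITm (extSI σ) t)
  subITm σ (br c)  = br (subICmd σ c)

  subICo : (ℕ → Inh) → CoTm → CoTm
  subICo σ nil        = nil
  subICo σ (cons u l) = cons (subITm σ u) (subICo σ l)
  subICo σ (icns B l) = icns (subI σ B) (subICo σ l)
  subICo σ (mu c)     = mu (subICmd σ c)

  subICmd : (ℕ → Inh) → Cmd → Cmd
  subICmd σ (cut t l) = cut (subITm σ t) (subICo σ l)

extS : (ℕ → Tm) → ℕ → Tm
extS σ zero    = var zero
extS σ (suc i) = renTm suc (σ i)

mutual
  subTm : (ℕ → Tm) → Tm → Tm
  subTm σ (var x) = σ x
  subTm σ (lam t) = lam (subTm (extS σ) t)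
  subTm σ (Lam t) = Lam (subTm (λ i → renITm suc (σ i)) t)
  subTm σ (br c)  = br (subCmd σ c)

  subCo : (ℕ → Tm) → CoTm → CoTm
  subCo σ nil        = nil
  subCo σ (cons u l) = cons (subTm σ u) (subCo σ l)
  subCo σ (icns B l) = icns B (subCo σ l)
  subCo σ (mu c)     = mu (subCmd (extS σ) c)

  subCmd : (ℕ → Tm) → Cmd → Cmd
  subCmd σ (cut t l) = cut (subTm σ t) (subCo σ l)

_•_ : Tm → ℕ → Tm
(t • zero)  = t
(t • suc i) = var i

_++_ : CoTm → CoTm → CoTm
nil ++ l'                  = l'
cons u l ++ l'             = cons u (l ++ l')
icns B l ++ l'             = icns B (l ++ l')
mu (cut t l) ++ l'         = mu (cut t (l ++ renCo suc l'))

data EvCtx : CoTm → Set where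
  ev-nil  : EvCtx nil
  ev-cons : ∀ {u l} → EvCtx (cons u l)
  ev-icns : ∀ {B l} → EvCtx (icns B l)

infix 4 _⟶t_ _⟶l_ _⟶c_
mutual
  data _⟶t_ : Tm → Tm → Set where
    ε     : ∀ {t} → br (cut t nil) ⟶t t
    lamξ  : ∀ {t t'} → t ⟶t t' → lam t ⟶t lam t'
    Lamξ  : ∀ {t t'} → t ⟶t t' → Lam t ⟶t Lam t'
    brξ   : ∀ {c c'} → c ⟶c c' → br c ⟶t br c'

  data _⟶l_ : CoTm → CoTm → Set where
    μ     : ∀ {l} → mu (cut (var zero) (renCo suc l)) ⟶l l
    consξ₁ : ∀ {u u' l} → u ⟶t u' → cons u l ⟶l cons u' l
    consξ₂ : ∀ {u l l'} → l ⟶l l' → cons u l ⟶l cons u l'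
    icnsξ₁ : ∀ {B B' l} → B ⟶₀ B' → icns B l ⟶l icns B' l
    icnsξ₂ : ∀ {B l l'} → l ⟶l l' → icns B l ⟶l icns B l'
    muξ   : ∀ {c c'} → c ⟶c c' → mu c ⟶l mu c'

  data _⟶c_ : Cmd → Cmd → Set where
    β₁ : ∀ {t u l} →
         cut (lam t) (cons u l) ⟶c cut u (mu (cut t (renCo suc l)))
    β₂ : ∀ {t B l} →
         cut (Lam t) (icns B l) ⟶c cut (subITm (B •I) t) l
    π  : ∀ {t l E} → EvCtx E → cut (br (cut t l)) E ⟶c cut t (l ++ E)
    σ′ : ∀ {t c} → cut t (mu c) ⟶c subCmd (t •_) c
    cutξ₁ : ∀ {t t' l} → t ⟶t t' → cut t l ⟶c cut t' l
    cutξ₂ : ∀ {t l l'} → l ⟶l l' → cut t l ⟶c cut t l'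

infixl 7 _·_ _·I_
data TTm : Set where
  tvar : ℕ → TTm
  ƛ    : TTm → TTm
  _·_  : TTm → TTm → TTm
  Λ    : TTm → TTm
  _·I_ : TTm → Inh → TTm

renT : (ℕ → ℕ) → TTm → TTm
renT ρ (tvar x) = tvar (ρ x)
renT ρ (ƛ t)    = ƛ (renT (extR ρ) t)
renT ρ (t · u)  = renT ρ t · renT ρ u
renT ρ (Λ t)    = Λ (renT ρ t)
renT ρ (t ·I A) = renT ρ t ·I A

renIT : (ℕ → ℕ) → TTm → TTm
renIT ρ (tvar x) = tvar x
renIT ρ (ƛ t)    = ƛ (renIT ρ t)
renIT ρ (t · u)  = renIT ρ t · renIT ρ u
renIT ρ (Λ t)    = Λ (renIT (extR ρ) t)
renIT ρ (t ·I A) = renIT ρ t ·I renI ρ A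

subIT : (ℕ → Inh) → TTm → TTm
subIT σ (tvar x) = tvar x
subIT σ (ƛ t)    = ƛ (subIT σ t)
subIT σ (t · u)  = subIT σ t · subIT σ u
subIT σ (Λ t)    = Λ (subIT (extSI σ) t)
subIT σ (t ·I A) = subIT σ t ·I subI σ A

extST : (ℕ → TTm) → ℕ → TTm
extST σ zero    = tvar zero
extST σ (suc i) = renT suc (σ i)

subT : (ℕ → TTm) → TTm → TTm
subT σ (tvar x) = σ x
subT σ (ƛ t)    = ƛ (subT (extST σ) t)
subT σ (t · u)  = subT σ t · subT σ u
subT σ (Λ t)    = Λ (subT (λ i → renIT suc (σ i)) t)
subT σ (t ·I A) = subT σ t ·I A

_•T : TTm → ℕ → TTm
(u •T) zero    = u
(u •T) (suc i) = tvar i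

infix 4 _⟶_ _⟶⁺_
data _⟶_ : TTm → TTm → Set where
  β   : ∀ {t u} → ƛ t · u ⟶ subT (u •T) t
  βΛ  : ∀ {t B} → Λ t ·I B ⟶ subIT (B •I) t
  ·Iβ₀ : ∀ {t B B'} → B ⟶₀ B' → t ·I B ⟶ t ·I B'
  ƛξ  : ∀ {t t'} → t ⟶ t' → ƛ t ⟶ ƛ t'
  ·ξ₁ : ∀ {t t' u} → t ⟶ t' → t · u ⟶ t' · u
  ·ξ₂ : ∀ {t u u'} → u ⟶ u' → t · u ⟶ t · u'
  Λξ  : ∀ {t t'} → t ⟶ t' → Λ t ⟶ Λ t'
  ·Iξ : ∀ {t t' B} → t ⟶ t' → t ·I B ⟶ t' ·I B

_⟶⁺_ : TTm → TTm → Set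
_⟶⁺_ = TransClosure _⟶_

data ScopedI (m : ℕ) : Inh → Set where
  ivar : ∀ {i} → i < m → ScopedI m (ivar i)
  ilam : ∀ {A} → ScopedI (suc m) A → ScopedI m (ilam A)
  iapp : ∀ {A B} → ScopedI m A → ScopedI m B → ScopedI m (iapp A B)
  imp  : ∀ {A B} → ScopedI m A → ScopedI m B → ScopedI m (A ⊃ B)
  iall : ∀ {D A} → ScopedI (suc m) A → ScopedI m (iall D A)

data ScopedT (n m : ℕ) : TTm → Set where
  tvar : ∀ {x} → x < n → ScopedT n m (tvar x)
  ƛ    : ∀ {t} → ScopedT (suc n) m t → ScopedT n m (ƛ t)
  _·_  : ∀ {t u} → ScopedT n m t → ScopedT n m u → ScopedT n m (t · u)
  Λ    : ∀ {t} → ScopedT n (suc m) t → ScopedT n m (Λ t)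
  _·I_ : ∀ {t A} → ScopedT n m t → ScopedI m A → ScopedT n m (t ·I A)

ClosedT : TTm → Set
ClosedT = ScopedT 0 0

-- Parameters:  b   : the fixed propositional variable ⊥ (free variable
--                    with de Bruijn index b at depth 0),
--              top : the fixed proposition ⊤,
--              s   : the fixed (closed) proof term of ⊤ ⊃ ⊤.
-- The depth d counts the inhabitant binders passed, so that ⊥ and ⊤
-- (free objects) are shifted correctly.  ρ maps proof variables of the
-- source expression to target de Bruijn indices (accounting for the
-- fresh variables w, m, g, k, y introduced by the translation).

module CGPS (b : ℕ) (top : Inh) (s : TTm) where

  Bot : ℕ → Inh
  Bot d = ivar (d + b)

  Top : ℕ → Inh
  Top d = renI (d +_) top

  neg : ℕ → Inh → Inh
  neg d A = A ⊃ Bot d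

  mutual
    star : ℕ → Inh → Inh
    star d (ivar i)   = ivar i
    star d (ilam A)   = ilam (star (suc d) A)
    star d (iapp A B) = iapp (star d A) (star d B)
    star d (A ⊃ B)    = neg d (ibar d B) ⊃ neg d (ibar d A)
    star d (iall D A) = iall D (ibar (suc d) A)

    ibar : ℕ → Inh → Inh
    ibar d A = Top d ⊃ neg d (neg d (star d A))

  plus : TTm → TTm
  plus G = s · G

  wk : TTm → TTm
  wk = renT suc

  wk2 : TTm → TTm
  wk2 t = renT suc (renT suc t)

  mutual
    trT : ℕ → (ℕ → ℕ) → Tm → TTm → TTm → TTm
    trT d ρ (var x) G K = tvar (ρ x) · plus G · K
    -- [K (λw x. w t̄) ; G]   (binders y, w, x)
    trT d ρ (lam t) G K =
      ƛ (wk K · ƛ (ƛ (tvar 1 · bar d (extR (λ i → 2 + ρ i)) t))) · G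
    -- [K (ΛX. t̄) ; G]       (binder y)
    trT d ρ (Lam t) G K =
      ƛ (wk K · Λ (bar (suc d) (λ i → suc (ρ i)) t)) · G
    trT d ρ (br c)  G K = trC d ρ c (plus G) K

    trL : ℕ → (ℕ → ℕ) → CoTm → TTm → TTm → TTm
    trL d ρ nil G K = ƛ (tvar 0 · wk G · wk K)
    trL d ρ (cons u l) G K =
      ƛ (tvar 0 · wk G
           · ƛ (tvar 0 · trL d (λ i → 2 + ρ i) l (wk2 G) (wk2 K)
                       · bar d (λ i → 2 + ρ i) u))
    trL d ρ (icns B l) G K =
      ƛ (tvar 0 · wk G
           · ƛ (trL d (λ i → 2 + ρ i) l (wk2 G) (wk2 K)
                 · (tvar 0 ·I star d B)))
    trL d ρ (mu c) G K = ƛ (trC d (extR ρ) c (wk G) (wk K))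

    trC : ℕ → (ℕ → ℕ) → Cmd → TTm → TTm → TTm
    trC d ρ (cut t nil) G K = trT d ρ t G K
    trC d ρ (cut t (cons u l)) G K =
      trT d ρ t G (ƛ (tvar 0 · trL d (λ i → suc (ρ i)) l (wk G) (wk K)
                             · bar d (λ i → suc (ρ i)) u))
    trC d ρ (cut t (icns B l)) G K =
      trT d ρ t G (ƛ (trL d (λ i → suc (ρ i)) l (wk G) (wk K)
                       · (tvar 0 ·I star d B)))
    trC d ρ (cut t (mu c)) G K = trL d ρ (mu c) G K · bar d ρ t

    bar : ℕ → (ℕ → ℕ) → Tm → TTm
    bar d ρ t = ƛ (ƛ (trT d (λ i → 2 + ρ i) t (tvar 1) (tvar 0)))

  ⟦_⟧ : Tm → TTm
  ⟦ t ⟧ = bar 0 (λ i → i) t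

-- The ω-fragments: no domain variables anywhere.

ωDom : Dom → Set
ωDom PROP    = ⊤
ωDom (dvar _) = ⊥
ωDom (D ⇒ E) = ωDom D × ωDom E

ωInh : Inh → Set
ωInh (ivar _)   = ⊤
ωInh (ilam A)   = ωInh A
ωInh (iapp A B) = ωInh A × ωInh B
ωInh (A ⊃ B)    = ωInh A × ωInh B
ωInh (iall D A) = ωDom D × ωInh A

mutual
  ωTm : Tm → Set
  ωTm (var _) = ⊤
  ωTm (lam t) = ωTm t
  ωTm (Lam t) = ωTm t
  ωTm (br c)  = ωCmd c

  ωCo : CoTm → Set
  ωCo nil        = ⊤
  ωCo (cons u l) = ωTm u × ωCo l
  ωCo (icns B l) = ωInh B × ωCo l
  ωCo (mu c)     = ωCmd c

  ωCmd : Cmd → Set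
  ωCmd (cut t l) = ωTm t × ωCo l

ωT : TTm → Set
ωT (tvar _) = ⊤
ωT (ƛ t)    = ωT t
ωT (t · u)  = ωT t × ωT u
ωT (Λ t)    = ωT t
ωT (t ·I A) = ωT t × ωInh A

infix 4 _⟶tω_ _⟶ω_ _⟶ω⁺_
_⟶tω_ : Tm → Tm → Set
t ⟶tω u = ωTm t × ωTm u × t ⟶t u

_⟶ω_ : TTm → TTm → Set
t ⟶ω u = ωT t × ωT u × t ⟶ u

_⟶ω⁺_ : TTm → TTm → Set
_⟶ω⁺_ = TransClosure _⟶ω_

module Submission where

open import Defs
open import Data.Nat using (ℕ; zero; suc; _+_; _<_; s≤s)
open import Data.Product using (_×_; _,_; ∃-syntax)
open import Data.Sum using (_⊎_; inj₁; inj₂)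
open import Data.Unit using (tt)
open import Relation.Binary.PropositionalEquality
open import Relation.Binary.Construct.Closure.ReflexiveTransitive
  using (Star; _◅_; _◅◅_; gmap) renaming (ε to ∎*)
open import Relation.Binary.Construct.Closure.Transitive using ([_]; _∷_)

-- Generalise (t : G, K) so that proof variables may denote arbitrary target terms.  This
-- translation commutes on the nose with renaming, with target substitution and with inhabitant
-- substitution (B becoming B*), and with source substitution up to reduction.  Appending an
-- evaluation context E to a co-term only replaces the continuation K by one determined by E.  A
-- root redex is then simulated by a few β-steps (β₁, β₂), by one β-step followed by the
-- substitution lemma (σ, and μ on a co-term (y)c), or by s G →⁺ G (ε, π and the remaining μ
-- cases); the other steps are congruences, and every construct of the translation passes
-- reduction of G and K through strictly.  For the ω-systems it remains to note that the
-- translation of an ω-term is an ω-term and that ω-terms reduce to ω-terms.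

extR-comp : ∀ {f g h : ℕ → ℕ} → (∀ i → f (g i) ≡ h i) → ∀ i → extR f (extR g i) ≡ extR h i
extR-comp p zero    = refl
extR-comp p (suc i) = cong suc (p i)

extR-id : ∀ {f} → (∀ i → f i ≡ i) → ∀ i → extR f i ≡ i
extR-id p zero    = refl
extR-id p (suc i) = cong suc (p i)

renI-comp : ∀ {f g h} → (∀ i → f (g i) ≡ h i) → ∀ A → renI f (renI g A) ≡ renI h A
renI-comp p (ivar i)   = cong ivar (p i)
renI-comp p (ilam A)   = cong ilam (renI-comp (extR-comp p) A)
renI-comp p (iapp A B) = cong₂ iapp (renI-comp p A) (renI-comp p B)
renI-comp p (A ⊃ B)    = cong₂ _⊃_ (renI-comp p A) (renI-comp p B)
renI-comp p (iall D A) = cong (iall D) (renI-comp (extR-comp p) A)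

renI-id : ∀ {f} → (∀ i → f i ≡ i) → ∀ A → renI f A ≡ A
renI-id p (ivar i)   = cong ivar (p i)
renI-id p (ilam A)   = cong ilam (renI-id (extR-id p) A)
renI-id p (iapp A B) = cong₂ iapp (renI-id p A) (renI-id p B)
renI-id p (A ⊃ B)    = cong₂ _⊃_ (renI-id p A) (renI-id p B)
renI-id p (iall D A) = cong (iall D) (renI-id (extR-id p) A)

extSI-extR : ∀ {τ g υ} → (∀ i → τ (g i) ≡ υ i) → ∀ i → extSI τ (extR g i) ≡ extSI υ i
extSI-extR p zero    = refl
extSI-extR p (suc i) = cong (renI suc) (p i)

subI-renI : ∀ {τ g υ} → (∀ i → τ (g i) ≡ υ i) → ∀ A → subI τ (renI g A) ≡ subI υ A
subI-renI p (ivar i)   = p i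
subI-renI p (ilam A)   = cong ilam (subI-renI (extSI-extR p) A)
subI-renI p (iapp A B) = cong₂ iapp (subI-renI p A) (subI-renI p B)
subI-renI p (A ⊃ B)    = cong₂ _⊃_ (subI-renI p A) (subI-renI p B)
subI-renI p (iall D A) = cong (iall D) (subI-renI (extSI-extR p) A)

renI-extSI : ∀ {f τ υ} → (∀ i → renI f (τ i) ≡ υ i) → ∀ i → renI (extR f) (extSI τ i) ≡ extSI υ i
renI-extSI p zero = refl
renI-extSI {f} {τ} {υ} p (suc i) = begin
  renI (extR f) (renI suc (τ i))  ≡⟨ renI-comp (λ _ → refl) (τ i) ⟩
  renI (λ j → suc (f j)) (τ i)    ≡⟨ renI-comp (λ _ → refl) (τ i) ⟨
  renI suc (renI f (τ i))         ≡⟨ cong (renI suc) (p i) ⟩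
  renI suc (υ i)                  ∎
  where open ≡-Reasoning

renI-subI : ∀ {f τ υ} → (∀ i → renI f (τ i) ≡ υ i) → ∀ A → renI f (subI τ A) ≡ subI υ A
renI-subI p (ivar i)   = p i
renI-subI p (ilam A)   = cong ilam (renI-subI (renI-extSI p) A)
renI-subI p (iapp A B) = cong₂ iapp (renI-subI p A) (renI-subI p B)
renI-subI p (A ⊃ B)    = cong₂ _⊃_ (renI-subI p A) (renI-subI p B)
renI-subI p (iall D A) = cong (iall D) (renI-subI (renI-extSI p) A)

extSI-var : ∀ {τ f} → (∀ i → τ i ≡ ivar (f i)) → ∀ i → extSI τ i ≡ ivar (extR f i)
extSI-var p zero    = refl
extSI-var p (suc i) = cong (renI suc) (p i)

subI-var : ∀ {τ f} → (∀ i → τ i ≡ ivar (f i)) → ∀ A → subI τ A ≡ renI f A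
subI-var p (ivar i)   = p i
subI-var p (ilam A)   = cong ilam (subI-var (extSI-var p) A)
subI-var p (iapp A B) = cong₂ iapp (subI-var p A) (subI-var p B)
subI-var p (A ⊃ B)    = cong₂ _⊃_ (subI-var p A) (subI-var p B)
subI-var p (iall D A) = cong (iall D) (subI-var (extSI-var p) A)

subI-id : ∀ {τ} → (∀ i → τ i ≡ ivar i) → ∀ A → subI τ A ≡ A
subI-id p A = trans (subI-var {f = λ i → i} p A) (renI-id (λ _ → refl) A)

extSI-scoped-id : ∀ {m τ} → (∀ i → i < m → τ i ≡ ivar i) → ∀ i → i < suc m → extSI τ i ≡ ivar i
extSI-scoped-id p zero    _       = refl
extSI-scoped-id p (suc i) (s≤s q) = cong (renI suc) (p i q)

subI-scoped-id : ∀ {m τ A} → ScopedI m A → (∀ i → i < m → τ i ≡ ivar i) → subI τ A ≡ A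
subI-scoped-id (ivar q)    p = p _ q
subI-scoped-id (ilam h)    p = cong ilam (subI-scoped-id h (extSI-scoped-id p))
subI-scoped-id (iapp h h') p = cong₂ iapp (subI-scoped-id h p) (subI-scoped-id h' p)
subI-scoped-id (imp h h')  p = cong₂ _⊃_ (subI-scoped-id h p) (subI-scoped-id h' p)
subI-scoped-id (iall h)    p = cong (iall _) (subI-scoped-id h (extSI-scoped-id p))

renI-subI-• : ∀ f B A → renI f (subI (B •I) A) ≡ subI (renI f B •I) (renI (extR f) A)
renI-subI-• f B A = trans (renI-subI (λ _ → refl) A) (sym (subI-renI q A))
  where q : ∀ i → (renI f B •I) (extR f i) ≡ renI f ((B •I) i)
        q zero    = refl
        q (suc i) = refl

renI-⟶₀ : ∀ {A A'} f → A ⟶₀ A' → renI f A ⟶₀ renI f A'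
renI-⟶₀ f (β₀ {A} {B}) = subst (renI f (iapp (ilam A) B) ⟶₀_) (sym (renI-subI-• f B A)) β₀
renI-⟶₀ f (ilamξ p) = ilamξ (renI-⟶₀ _ p)
renI-⟶₀ f (iappl p) = iappl (renI-⟶₀ f p)
renI-⟶₀ f (iappr p) = iappr (renI-⟶₀ f p)
renI-⟶₀ f (impl p)  = impl (renI-⟶₀ f p)
renI-⟶₀ f (impr p)  = impr (renI-⟶₀ f p)
renI-⟶₀ f (iallξ p) = iallξ (renI-⟶₀ _ p)

renT-comp : ∀ {f g h} → (∀ i → f (g i) ≡ h i) → ∀ X → renT f (renT g X) ≡ renT h X
renT-comp p (tvar x) = cong tvar (p x)
renT-comp p (ƛ X)    = cong ƛ (renT-comp (extR-comp p) X)
renT-comp p (X · Y)  = cong₂ _·_ (renT-comp p X) (renT-comp p Y)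
renT-comp p (Λ X)    = cong Λ (renT-comp p X)
renT-comp p (X ·I A) = cong (_·I A) (renT-comp p X)

renT-id : ∀ {f} → (∀ i → f i ≡ i) → ∀ X → renT f X ≡ X
renT-id p (tvar x) = cong tvar (p x)
renT-id p (ƛ X)    = cong ƛ (renT-id (extR-id p) X)
renT-id p (X · Y)  = cong₂ _·_ (renT-id p X) (renT-id p Y)
renT-id p (Λ X)    = cong Λ (renT-id p X)
renT-id p (X ·I A) = cong (_·I A) (renT-id p X)

renT-ext-wk : ∀ f X → renT (extR f) (renT suc X) ≡ renT suc (renT f X)
renT-ext-wk f X = trans (renT-comp (λ _ → refl) X) (sym (renT-comp (λ _ → refl) X))

renIT-comp : ∀ {f g h} → (∀ i → f (g i) ≡ h i) → ∀ X → renIT f (renIT g X) ≡ renIT h X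
renIT-comp p (tvar x) = refl
renIT-comp p (ƛ X)    = cong ƛ (renIT-comp p X)
renIT-comp p (X · Y)  = cong₂ _·_ (renIT-comp p X) (renIT-comp p Y)
renIT-comp p (Λ X)    = cong Λ (renIT-comp (extR-comp p) X)
renIT-comp p (X ·I A) = cong₂ _·I_ (renIT-comp p X) (renI-comp p A)

renT-renIT : ∀ f g X → renT f (renIT g X) ≡ renIT g (renT f X)
renT-renIT f g (tvar x) = refl
renT-renIT f g (ƛ X)    = cong ƛ (renT-renIT _ g X)
renT-renIT f g (X · Y)  = cong₂ _·_ (renT-renIT f g X) (renT-renIT f g Y)
renT-renIT f g (Λ X)    = cong Λ (renT-renIT f _ X)
renT-renIT f g (X ·I A) = cong (_·I renI g A) (renT-renIT f g X)

renT-subIT : ∀ f τ X → renT f (subIT τ X) ≡ subIT τ (renT f X)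
renT-subIT f τ (tvar x) = refl
renT-subIT f τ (ƛ X)    = cong ƛ (renT-subIT _ τ X)
renT-subIT f τ (X · Y)  = cong₂ _·_ (renT-subIT f τ X) (renT-subIT f τ Y)
renT-subIT f τ (Λ X)    = cong Λ (renT-subIT f _ X)
renT-subIT f τ (X ·I A) = cong (_·I subI τ A) (renT-subIT f τ X)

extST-extR : ∀ {σ g τ} → (∀ i → σ (g i) ≡ τ i) → ∀ i → extST σ (extR g i) ≡ extST τ i
extST-extR p zero    = refl
extST-extR p (suc i) = cong (renT suc) (p i)

subT-renT : ∀ {σ g τ} → (∀ i → σ (g i) ≡ τ i) → ∀ X → subT σ (renT g X) ≡ subT τ X
subT-renT p (tvar x) = p x
subT-renT p (ƛ X)    = cong ƛ (subT-renT (extST-extR p) X)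
subT-renT p (X · Y)  = cong₂ _·_ (subT-renT p X) (subT-renT p Y)
subT-renT p (Λ X)    = cong Λ (subT-renT (λ i → cong (renIT suc) (p i)) X)
subT-renT p (X ·I A) = cong (_·I A) (subT-renT p X)

renT-extST : ∀ {f σ τ} → (∀ i → renT f (σ i) ≡ τ i) → ∀ i → renT (extR f) (extST σ i) ≡ extST τ i
renT-extST p zero = refl
renT-extST {f} {σ} {τ} p (suc i) = begin
  renT (extR f) (renT suc (σ i))  ≡⟨ renT-ext-wk f (σ i) ⟩
  renT suc (renT f (σ i))         ≡⟨ cong (renT suc) (p i) ⟩
  renT suc (τ i)                  ∎
  where open ≡-Reasoning

renT-subT : ∀ {f σ τ} → (∀ i → renT f (σ i) ≡ τ i) → ∀ X → renT f (subT σ X) ≡ subT τ X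
renT-subT p (tvar x) = p x
renT-subT p (ƛ X)    = cong ƛ (renT-subT (renT-extST p) X)
renT-subT p (X · Y)  = cong₂ _·_ (renT-subT p X) (renT-subT p Y)
renT-subT {f} {σ} p (Λ X) =
  cong Λ (renT-subT (λ i → trans (renT-renIT f suc (σ i)) (cong (renIT suc) (p i))) X)
renT-subT p (X ·I A) = cong (_·I A) (renT-subT p X)

extST-var : ∀ {σ f} → (∀ i → σ i ≡ tvar (f i)) → ∀ i → extST σ i ≡ tvar (extR f i)
extST-var p zero    = refl
extST-var p (suc i) = cong (renT suc) (p i)

subT-var : ∀ {σ f} → (∀ i → σ i ≡ tvar (f i)) → ∀ X → subT σ X ≡ renT f X
subT-var p (tvar x) = p x
subT-var p (ƛ X)    = cong ƛ (subT-var (extST-var p) X)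
subT-var p (X · Y)  = cong₂ _·_ (subT-var p X) (subT-var p Y)
subT-var p (Λ X)    = cong Λ (subT-var (λ i → cong (renIT suc) (p i)) X)
subT-var p (X ·I A) = cong (_·I A) (subT-var p X)

subT-id : ∀ {σ} → (∀ i → σ i ≡ tvar i) → ∀ X → subT σ X ≡ X
subT-id p X = trans (subT-var {f = λ i → i} p X) (renT-id (λ _ → refl) X)

subT-scoped-id : ∀ {n m σ X} → ScopedT n m X → (∀ i → i < n → σ i ≡ tvar i) → subT σ X ≡ X
subT-scoped-id (tvar q)  p = p _ q
subT-scoped-id (ƛ h)     p = cong ƛ (subT-scoped-id h q)
  where q : ∀ i → i < suc _ → extST _ i ≡ tvar i
        q zero    _       = refl
        q (suc i) (s≤s r) = cong (renT suc) (p i r)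
subT-scoped-id (h · h')  p = cong₂ _·_ (subT-scoped-id h p) (subT-scoped-id h' p)
subT-scoped-id (Λ h)     p = cong Λ (subT-scoped-id h (λ i q → cong (renIT suc) (p i q)))
subT-scoped-id (h ·I h') p = cong (_·I _) (subT-scoped-id h p)

subT-ext-wk : ∀ σ X → subT (extST σ) (renT suc X) ≡ renT suc (subT σ X)
subT-ext-wk σ X = trans (subT-renT (λ _ → refl) X) (sym (renT-subT (λ _ → refl) X))

subT-•-wk : ∀ u X → subT (u •T) (renT suc X) ≡ X
subT-•-wk u X = trans (subT-renT {τ = tvar} (λ _ → refl) X) (subT-id (λ _ → refl) X)

subT-ext²-wk2 : ∀ σ X → subT (extST (extST σ)) (renT suc (renT suc X)) ≡ renT suc (renT suc (subT σ X))
subT-ext²-wk2 σ X = trans (subT-ext-wk (extST σ) (renT suc X)) (cong (renT suc) (subT-ext-wk σ X))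

subT-ext-•-wk2 : ∀ X Y → subT (extST (X •T)) (renT suc (renT suc Y)) ≡ renT suc Y
subT-ext-•-wk2 X Y = trans (subT-ext-wk (X •T) (renT suc Y)) (cong (renT suc) (subT-•-wk X Y))

renIT-extST : ∀ {f σ τ} → (∀ i → renIT f (σ i) ≡ τ i) → ∀ i → renIT f (extST σ i) ≡ extST τ i
renIT-extST p zero = refl
renIT-extST {f} {σ} p (suc i) = trans (sym (renT-renIT suc f (σ i))) (cong (renT suc) (p i))

renIT-subT : ∀ {f σ τ} → (∀ i → renIT f (σ i) ≡ τ i) → ∀ X → renIT f (subT σ X) ≡ subT τ (renIT f X)
renIT-subT p (tvar x) = p x
renIT-subT p (ƛ X)    = cong ƛ (renIT-subT (renIT-extST p) X)
renIT-subT p (X · Y)  = cong₂ _·_ (renIT-subT p X) (renIT-subT p Y)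
renIT-subT {f} {σ} {τ} p (Λ X) = cong Λ (renIT-subT q X)
  where q : ∀ i → renIT (extR f) (renIT suc (σ i)) ≡ renIT suc (τ i)
        q i = begin
          renIT (extR f) (renIT suc (σ i))  ≡⟨ renIT-comp (λ _ → refl) (σ i) ⟩
          renIT (λ j → suc (f j)) (σ i)     ≡⟨ renIT-comp (λ _ → refl) (σ i) ⟨
          renIT suc (renIT f (σ i))         ≡⟨ cong (renIT suc) (p i) ⟩
          renIT suc (τ i)                   ∎
          where open ≡-Reasoning
renIT-subT p (X ·I A) = cong (_·I _) (renIT-subT p X)

renIT-subIT : ∀ {f τ υ} → (∀ i → renI f (τ i) ≡ υ i) → ∀ X → renIT f (subIT τ X) ≡ subIT υ X
renIT-subIT p (tvar x) = refl
renIT-subIT p (ƛ X)    = cong ƛ (renIT-subIT p X)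
renIT-subIT p (X · Y)  = cong₂ _·_ (renIT-subIT p X) (renIT-subIT p Y)
renIT-subIT p (Λ X)    = cong Λ (renIT-subIT (renI-extSI p) X)
renIT-subIT p (X ·I A) = cong₂ _·I_ (renIT-subIT p X) (renI-subI p A)

subIT-renIT : ∀ {τ g υ} → (∀ i → τ (g i) ≡ υ i) → ∀ X → subIT τ (renIT g X) ≡ subIT υ X
subIT-renIT p (tvar x) = refl
subIT-renIT p (ƛ X)    = cong ƛ (subIT-renIT p X)
subIT-renIT p (X · Y)  = cong₂ _·_ (subIT-renIT p X) (subIT-renIT p Y)
subIT-renIT p (Λ X)    = cong Λ (subIT-renIT (extSI-extR p) X)
subIT-renIT p (X ·I A) = cong₂ _·I_ (subIT-renIT p X) (subI-renI p A)

extSI-id : ∀ {τ} → (∀ i → τ i ≡ ivar i) → ∀ i → extSI τ i ≡ ivar i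
extSI-id p zero    = refl
extSI-id p (suc i) = cong (renI suc) (p i)

subIT-id : ∀ {τ} → (∀ i → τ i ≡ ivar i) → ∀ X → subIT τ X ≡ X
subIT-id p (tvar x) = refl
subIT-id p (ƛ X)    = cong ƛ (subIT-id p X)
subIT-id p (X · Y)  = cong₂ _·_ (subIT-id p X) (subIT-id p Y)
subIT-id p (Λ X)    = cong Λ (subIT-id (extSI-id p) X)
subIT-id p (X ·I A) = cong₂ _·I_ (subIT-id p X) (subI-id p A)

subIT-var : ∀ {τ f} → (∀ i → τ i ≡ ivar (f i)) → ∀ X → subIT τ X ≡ renIT f X
subIT-var p (tvar x) = refl
subIT-var p (ƛ X)    = cong ƛ (subIT-var p X)
subIT-var p (X · Y)  = cong₂ _·_ (subIT-var p X) (subIT-var p Y)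
subIT-var p (Λ X)    = cong Λ (subIT-var (extSI-var p) X)
subIT-var p (X ·I A) = cong₂ _·I_ (subIT-var p X) (subI-var p A)

subIT-scoped-id : ∀ {n m τ X} → ScopedT n m X → (∀ i → i < m → τ i ≡ ivar i) → subIT τ X ≡ X
subIT-scoped-id (tvar x)  p = refl
subIT-scoped-id (ƛ h)     p = cong ƛ (subIT-scoped-id h p)
subIT-scoped-id (h · h')  p = cong₂ _·_ (subIT-scoped-id h p) (subIT-scoped-id h' p)
subIT-scoped-id (Λ h)     p = cong Λ (subIT-scoped-id h (extSI-scoped-id p))
subIT-scoped-id (h ·I h') p = cong₂ _·I_ (subIT-scoped-id h p) (subI-scoped-id h' p)

subIT-ext-renIT-suc : ∀ τ X → subIT (extSI τ) (renIT suc X) ≡ renIT suc (subIT τ X)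
subIT-ext-renIT-suc τ X = trans (subIT-renIT (λ _ → refl) X) (sym (renIT-subIT (λ _ → refl) X))

subIT-•-renIT : ∀ B X → subIT (B •I) (renIT suc X) ≡ X
subIT-•-renIT B X = trans (subIT-renIT {υ = ivar} (λ _ → refl) X) (subIT-id (λ _ → refl) X)

infix 4 _⟶*_
_⟶*_ : TTm → TTm → Set
_⟶*_ = Star _⟶_

⁺⇒* : ∀ {t u} → t ⟶⁺ u → t ⟶* u
⁺⇒* [ x ]   = x ◅ ∎*
⁺⇒* (x ∷ p) = x ◅ ⁺⇒* p

infixr 5 _⁺◅*_
_⁺◅*_ : ∀ {t u v} → t ⟶⁺ u → u ⟶* v → t ⟶⁺ v
[ x ]   ⁺◅* ∎*      = [ x ]
[ x ]   ⁺◅* (y ◅ q) = x ∷ ([ y ] ⁺◅* q)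
(x ∷ p) ⁺◅* q       = x ∷ (p ⁺◅* q)

≡⇒* : ∀ {t u} → t ≡ u → t ⟶* u
≡⇒* refl = ∎*

≡⁺≡ : ∀ {t t' u' u} → t ≡ t' → t' ⟶⁺ u' → u' ≡ u → t ⟶⁺ u
≡⁺≡ refl p refl = p

step≡ : ∀ {t u v} → t ⟶ u → u ≡ v → t ⟶ v
step≡ p refl = p

map⁺ : ∀ (f : TTm → TTm) → (∀ {x y} → x ⟶ y → f x ⟶ f y) → ∀ {x y} → x ⟶⁺ y → f x ⟶⁺ f y
map⁺ f g [ x ]   = [ g x ]
map⁺ f g (x ∷ p) = g x ∷ map⁺ f g p

ƛ* : ∀ {x y} → x ⟶* y → ƛ x ⟶* ƛ y
ƛ* = gmap ƛ ƛξ

ƛ⁺ : ∀ {x y} → x ⟶⁺ y → ƛ x ⟶⁺ ƛ y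
ƛ⁺ = map⁺ ƛ ƛξ

Λ* : ∀ {x y} → x ⟶* y → Λ x ⟶* Λ y
Λ* = gmap Λ Λξ

Λ⁺ : ∀ {x y} → x ⟶⁺ y → Λ x ⟶⁺ Λ y
Λ⁺ = map⁺ Λ Λξ

·₁* : ∀ {x y} z → x ⟶* y → x · z ⟶* y · z
·₁* z = gmap (_· z) ·ξ₁

·₁⁺ : ∀ {x y} z → x ⟶⁺ y → x · z ⟶⁺ y · z
·₁⁺ z = map⁺ (_· z) ·ξ₁

·₂* : ∀ z {x y} → x ⟶* y → z · x ⟶* z · y
·₂* z = gmap (z ·_) ·ξ₂

·₂⁺ : ∀ z {x y} → x ⟶⁺ y → z · x ⟶⁺ z · y
·₂⁺ z = map⁺ (z ·_) ·ξ₂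

·* : ∀ {x y x' y'} → x ⟶* x' → y ⟶* y' → x · y ⟶* x' · y'
·* {y = y} {x' = x'} p q = ·₁* y p ◅◅ ·₂* x' q

renT-subT-• : ∀ f u t → renT f (subT (u •T) t) ≡ subT (renT f u •T) (renT (extR f) t)
renT-subT-• f u t = trans (renT-subT (λ _ → refl) t) (sym (subT-renT q t))
  where q : ∀ i → (renT f u •T) (extR f i) ≡ renT f ((u •T) i)
        q zero    = refl
        q (suc i) = refl

renT-⟶ : ∀ f {x y} → x ⟶ y → renT f x ⟶ renT f y
renT-⟶ f (β {t} {u})  = step≡ β (sym (renT-subT-• f u t))
renT-⟶ f (βΛ {t} {B}) = step≡ βΛ (sym (renT-subIT f (B •I) t))
renT-⟶ f (·Iβ₀ p)     = ·Iβ₀ p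
renT-⟶ f (ƛξ p)       = ƛξ (renT-⟶ _ p)
renT-⟶ f (·ξ₁ p)      = ·ξ₁ (renT-⟶ f p)
renT-⟶ f (·ξ₂ p)      = ·ξ₂ (renT-⟶ f p)
renT-⟶ f (Λξ p)       = Λξ (renT-⟶ f p)
renT-⟶ f (·Iξ p)      = ·Iξ (renT-⟶ f p)

renT-⟶* : ∀ f {x y} → x ⟶* y → renT f x ⟶* renT f y
renT-⟶* f = gmap (renT f) (renT-⟶ f)

renT-⟶⁺ : ∀ f {x y} → x ⟶⁺ y → renT f x ⟶⁺ renT f y
renT-⟶⁺ f = map⁺ (renT f) (renT-⟶ f)

renIT-subT-• : ∀ f u t → renIT f (subT (u •T) t) ≡ subT (renIT f u •T) (renIT f t)
renIT-subT-• f u t = renIT-subT q t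
  where q : ∀ i → renIT f ((u •T) i) ≡ (renIT f u •T) i
        q zero    = refl
        q (suc i) = refl

renIT-subIT-• : ∀ f B t → renIT f (subIT (B •I) t) ≡ subIT (renI f B •I) (renIT (extR f) t)
renIT-subIT-• f B t = trans (renIT-subIT (λ _ → refl) t) (sym (subIT-renIT q t))
  where q : ∀ i → (renI f B •I) (extR f i) ≡ renI f ((B •I) i)
        q zero    = refl
        q (suc i) = refl

renIT-⟶ : ∀ f {x y} → x ⟶ y → renIT f x ⟶ renIT f y
renIT-⟶ f (β {t} {u})  = step≡ β (sym (renIT-subT-• f u t))
renIT-⟶ f (βΛ {t} {B}) = step≡ βΛ (sym (renIT-subIT-• f B t))
renIT-⟶ f (·Iβ₀ p)     = ·Iβ₀ (renI-⟶₀ f p)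
renIT-⟶ f (ƛξ p)       = ƛξ (renIT-⟶ f p)
renIT-⟶ f (·ξ₁ p)      = ·ξ₁ (renIT-⟶ f p)
renIT-⟶ f (·ξ₂ p)      = ·ξ₂ (renIT-⟶ f p)
renIT-⟶ f (Λξ p)       = Λξ (renIT-⟶ _ p)
renIT-⟶ f (·Iξ p)      = ·Iξ (renIT-⟶ f p)

renIT-⟶* : ∀ f {x y} → x ⟶* y → renIT f x ⟶* renIT f y
renIT-⟶* f = gmap (renIT f) (renIT-⟶ f)

extS-id : ∀ {σ} → (∀ i → σ i ≡ var i) → ∀ i → extS σ i ≡ var i
extS-id p zero    = refl
extS-id p (suc i) = cong (renTm suc) (p i)

mutual
  subTm-id : ∀ {σ} → (∀ i → σ i ≡ var i) → ∀ t → subTm σ t ≡ t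
  subTm-id p (var x) = p x
  subTm-id p (lam t) = cong lam (subTm-id (extS-id p) t)
  subTm-id p (Lam t) = cong Lam (subTm-id (λ i → cong (renITm suc) (p i)) t)
  subTm-id p (br c)  = cong br (subCmd-id p c)

  subCo-id : ∀ {σ} → (∀ i → σ i ≡ var i) → ∀ l → subCo σ l ≡ l
  subCo-id p nil        = refl
  subCo-id p (cons u l) = cong₂ cons (subTm-id p u) (subCo-id p l)
  subCo-id p (icns B l) = cong (icns B) (subCo-id p l)
  subCo-id p (mu c)     = cong mu (subCmd-id (extS-id p) c)

  subCmd-id : ∀ {σ} → (∀ i → σ i ≡ var i) → ∀ c → subCmd σ c ≡ c
  subCmd-id p (cut t l) = cong₂ cut (subTm-id p t) (subCo-id p l)

mutual
  subITm-var : ∀ {τ f} → (∀ i → τ i ≡ ivar (f i)) → ∀ t → subITm τ t ≡ renITm f t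
  subITm-var p (var x) = refl
  subITm-var p (lam t) = cong lam (subITm-var p t)
  subITm-var p (Lam t) = cong Lam (subITm-var (extSI-var p) t)
  subITm-var p (br c)  = cong br (subICmd-var p c)

  subICo-var : ∀ {τ f} → (∀ i → τ i ≡ ivar (f i)) → ∀ l → subICo τ l ≡ renICo f l
  subICo-var p nil        = refl
  subICo-var p (cons u l) = cong₂ cons (subITm-var p u) (subICo-var p l)
  subICo-var p (icns B l) = cong₂ icns (subI-var p B) (subICo-var p l)
  subICo-var p (mu c)     = cong mu (subICmd-var p c)

  subICmd-var : ∀ {τ f} → (∀ i → τ i ≡ ivar (f i)) → ∀ c → subICmd τ c ≡ renICmd f c
  subICmd-var p (cut t l) = cong₂ cut (subITm-var p t) (subICo-var p l)

EvCtx-renCo : ∀ {E} f → EvCtx E → EvCtx (renCo f E)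
EvCtx-renCo f ev-nil  = ev-nil
EvCtx-renCo f ev-cons = ev-cons
EvCtx-renCo f ev-icns = ev-icns

-- The inhabitant translation, and the proof translation with environments

module CGPSᵉ (b : ℕ) (top : Inh) (s : TTm) where
  open CGPS b top s

  renI-star : ∀ {f d d'} → (∀ i → f (d + i) ≡ d' + i) → ∀ A → renI f (star d A) ≡ star d' (renI f A)
  renI-ibar : ∀ {f d d'} → (∀ i → f (d + i) ≡ d' + i) → ∀ A → renI f (ibar d A) ≡ ibar d' (renI f A)
  renI-star p (ivar i)   = refl
  renI-star p (ilam A)   = cong ilam (renI-star (λ i → cong suc (p i)) A)
  renI-star p (iapp A B) = cong₂ iapp (renI-star p A) (renI-star p B)
  renI-star p (A ⊃ B)    =
    cong₂ _⊃_ (cong₂ _⊃_ (renI-ibar p B) (cong ivar (p b))) (cong₂ _⊃_ (renI-ibar p A) (cong ivar (p b)))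
  renI-star p (iall D A) = cong (iall D) (renI-ibar (λ i → cong suc (p i)) A)
  renI-ibar p A =
    cong₂ _⊃_ (renI-comp p top) (cong₂ _⊃_ (cong₂ _⊃_ (renI-star p A) (cong ivar (p b))) (cong ivar (p b)))

  -- At depth d the variables d, d + 1, … are the free variables of ⊥ and ⊤; the translation
  -- commutes with inhabitant substitutions that leave them alone.
  record Shifts (d d' : ℕ) (τ : ℕ → Inh) : Set where
    constructor shifts
    field shifted : ∀ i → τ (d + i) ≡ ivar (d' + i)

  record StarOf (d : ℕ) (τ τ' : ℕ → Inh) : Set where
    constructor starOf
    field starred : ∀ i → τ i ≡ star d (τ' i)

  open Shifts
  open StarOf

  Shifts-extSI : ∀ {d d' τ} → Shifts d d' τ → Shifts (suc d) (suc d') (extSI τ)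
  Shifts-extSI p = shifts λ i → cong (renI suc) (shifted p i)

  StarOf-extSI : ∀ {d τ τ'} → StarOf d τ τ' → StarOf (suc d) (extSI τ) (extSI τ')
  StarOf-extSI {τ' = τ'} p = starOf λ where
    zero    → refl
    (suc i) → trans (cong (renI suc) (starred p i)) (renI-star (λ _ → refl) (τ' i))

  StarOf-Shifts : ∀ {d d' τ τ'} → Shifts d d' τ' → StarOf d' τ τ' → Shifts d d' τ
  StarOf-Shifts {d' = d'} p q = shifts λ i → trans (starred q _) (cong (star d') (shifted p i))

  subI-star : ∀ {d d' τ τ'} → Shifts d d' τ' → StarOf d' τ τ' → ∀ A → subI τ (star d A) ≡ star d' (subI τ' A)
  subI-ibar : ∀ {d d' τ τ'} → Shifts d d' τ' → StarOf d' τ τ' → ∀ A → subI τ (ibar d A) ≡ ibar d' (subI τ' A)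
  subI-star p q (ivar i)   = starred q i
  subI-star p q (ilam A)   = cong ilam (subI-star (Shifts-extSI p) (StarOf-extSI q) A)
  subI-star p q (iapp A B) = cong₂ iapp (subI-star p q A) (subI-star p q B)
  subI-star p q (A ⊃ B)    =
    cong₂ _⊃_ (cong₂ _⊃_ (subI-ibar p q B) (shifted (StarOf-Shifts p q) b)) (cong₂ _⊃_ (subI-ibar p q A) (shifted (StarOf-Shifts p q) b))
  subI-star p q (iall D A) = cong (iall D) (subI-ibar (Shifts-extSI p) (StarOf-extSI q) A)
  subI-ibar {d} {d'} {τ} p q A =
    cong₂ _⊃_ (trans (subI-renI {υ = λ i → τ (d + i)} (λ _ → refl) top) (subI-var {f = d' +_} (shifted (StarOf-Shifts p q)) top))
      (cong₂ _⊃_ (cong₂ _⊃_ (subI-star p q A) (shifted (StarOf-Shifts p q) b)) (shifted (StarOf-Shifts p q) b))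

  StarOf-• : ∀ d B → StarOf d (star d B •I) (B •I)
  StarOf-• d B = starOf λ where
    zero    → refl
    (suc i) → refl

  star-⟶₀ : ∀ d {A A'} → A ⟶₀ A' → star d A ⟶₀ star d A'
  star-⟶₀ d (β₀ {A} {B}) = subst (star d (iapp (ilam A) B) ⟶₀_) (subI-star (shifts λ _ → refl) (StarOf-• d B) A) β₀
  star-⟶₀ d (ilamξ p) = ilamξ (star-⟶₀ _ p)
  star-⟶₀ d (iappl p) = iappl (star-⟶₀ d p)
  star-⟶₀ d (iappr p) = iappr (star-⟶₀ d p)
  star-⟶₀ d (impl p)  = impr (impl (impr (impl (impl (star-⟶₀ d p)))))
  star-⟶₀ d (impr p)  = impl (impl (impr (impl (impl (star-⟶₀ d p)))))
  star-⟶₀ d (iallξ p) = iallξ (impr (impl (impl (star-⟶₀ _ p))))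

  -- The proof translation with proof variables denoting arbitrary target terms instead of
  -- de Bruijn indices; unlike trT it is stable under substitution.
  Env : Set
  Env = ℕ → TTm

  mutual
    trTᵉ : ℕ → Env → Tm → TTm → TTm → TTm
    trTᵉ d e (var x) G K = e x · plus G · K
    trTᵉ d e (lam t) G K = ƛ (wk K · ƛ (ƛ (tvar 1 · barᵉ d (extST (λ i → wk2 (e i))) t))) · G
    trTᵉ d e (Lam t) G K = ƛ (wk K · Λ (barᵉ (suc d) (λ i → renIT suc (wk (e i))) t)) · G
    trTᵉ d e (br c) G K = trCᵉ d e c (plus G) K

    trLᵉ : ℕ → Env → CoTm → TTm → TTm → TTm
    trLᵉ d e nil G K = ƛ (tvar 0 · wk G · wk K)
    trLᵉ d e (cons u l) G K =
      ƛ (tvar 0 · wk G · ƛ (tvar 0 · trLᵉ d (λ i → wk2 (e i)) l (wk2 G) (wk2 K) · barᵉ d (λ i → wk2 (e i)) u))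
    trLᵉ d e (icns B l) G K =
      ƛ (tvar 0 · wk G · ƛ (trLᵉ d (λ i → wk2 (e i)) l (wk2 G) (wk2 K) · (tvar 0 ·I star d B)))
    trLᵉ d e (mu c) G K = ƛ (trCᵉ d (extST e) c (wk G) (wk K))

    trCᵉ : ℕ → Env → Cmd → TTm → TTm → TTm
    trCᵉ d e (cut t nil) G K = trTᵉ d e t G K
    trCᵉ d e (cut t (cons u l)) G K =
      trTᵉ d e t G (ƛ (tvar 0 · trLᵉ d (λ i → wk (e i)) l (wk G) (wk K) · barᵉ d (λ i → wk (e i)) u))
    trCᵉ d e (cut t (icns B l)) G K =
      trTᵉ d e t G (ƛ (trLᵉ d (λ i → wk (e i)) l (wk G) (wk K) · (tvar 0 ·I star d B)))
    trCᵉ d e (cut t (mu c)) G K = trLᵉ d e (mu c) G K · barᵉ d e t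

    barᵉ : ℕ → Env → Tm → TTm
    barᵉ d e t = ƛ (ƛ (trTᵉ d (λ i → wk2 (e i)) t (tvar 1) (tvar 0)))

  mutual
    trT≡trTᵉ : ∀ d {ρ e} → (∀ i → e i ≡ tvar (ρ i)) → ∀ t G K → trT d ρ t G K ≡ trTᵉ d e t G K
    trT≡trTᵉ d p (var x) G K = cong (λ z → z · plus G · K) (sym (p x))
    trT≡trTᵉ d p (lam t) G K =
      cong (λ z → ƛ (wk K · ƛ (ƛ (tvar 1 · z))) · G) (bar≡barᵉ d (extST-var (λ i → cong wk2 (p i))) t)
    trT≡trTᵉ d p (Lam t) G K = cong (λ z → ƛ (wk K · Λ z) · G) (bar≡barᵉ (suc d) (λ i → cong (λ z → renIT suc (wk z)) (p i)) t)
    trT≡trTᵉ d p (br c) G K = trC≡trCᵉ d p c (plus G) K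

    trL≡trLᵉ : ∀ d {ρ e} → (∀ i → e i ≡ tvar (ρ i)) → ∀ l G K → trL d ρ l G K ≡ trLᵉ d e l G K
    trL≡trLᵉ d p nil G K = refl
    trL≡trLᵉ d p (cons u l) G K =
      cong₂ (λ z w → ƛ (tvar 0 · wk G · ƛ (tvar 0 · z · w)))
        (trL≡trLᵉ d (λ i → cong wk2 (p i)) l _ _) (bar≡barᵉ d (λ i → cong wk2 (p i)) u)
    trL≡trLᵉ d p (icns B l) G K =
      cong (λ z → ƛ (tvar 0 · wk G · ƛ (z · (tvar 0 ·I star d B)))) (trL≡trLᵉ d (λ i → cong wk2 (p i)) l _ _)
    trL≡trLᵉ d p (mu c) G K = cong ƛ (trC≡trCᵉ d (extST-var p) c _ _)

    trC≡trCᵉ : ∀ d {ρ e} → (∀ i → e i ≡ tvar (ρ i)) → ∀ c G K → trC d ρ c G K ≡ trCᵉ d e c G K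
    trC≡trCᵉ d p (cut t nil) G K = trT≡trTᵉ d p t G K
    trC≡trCᵉ d {ρ} p (cut t (cons u l)) G K =
      trans (cong (λ z → trT d ρ t G z)
               (cong₂ (λ z w → ƛ (tvar 0 · z · w)) (trL≡trLᵉ d (λ i → cong wk (p i)) l _ _) (bar≡barᵉ d (λ i → cong wk (p i)) u)))
            (trT≡trTᵉ d p t G _)
    trC≡trCᵉ d {ρ} p (cut t (icns B l)) G K =
      trans (cong (λ z → trT d ρ t G (ƛ (z · (tvar 0 ·I star d B)))) (trL≡trLᵉ d (λ i → cong wk (p i)) l _ _))
            (trT≡trTᵉ d p t G _)
    trC≡trCᵉ d p (cut t (mu c)) G K = cong₂ _·_ (trL≡trLᵉ d p (mu c) G K) (bar≡barᵉ d p t)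

    bar≡barᵉ : ∀ d {ρ e} → (∀ i → e i ≡ tvar (ρ i)) → ∀ t → bar d ρ t ≡ barᵉ d e t
    bar≡barᵉ d p t = cong (λ z → ƛ (ƛ z)) (trT≡trTᵉ d (λ i → cong wk2 (p i)) t _ _)

  ⟦⟧≡barᵉ : ∀ t → ⟦ t ⟧ ≡ barᵉ 0 tvar t
  ⟦⟧≡barᵉ t = bar≡barᵉ 0 (λ _ → refl) t

-- Syntactic properties of the translation

module CGPS-Properties (b : ℕ) (top : Inh) (s : TTm) (s-closed : ClosedT s) where
  open CGPS b top s
  open CGPSᵉ b top s

  mutual
    trTᵉ-renTm : ∀ d {e e' f} → (∀ i → e (f i) ≡ e' i) → ∀ t G K → trTᵉ d e (renTm f t) G K ≡ trTᵉ d e' t G K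
    trTᵉ-renTm d p (var x) G K = cong (λ z → z · plus G · K) (p x)
    trTᵉ-renTm d p (lam t) G K =
      cong (λ z → ƛ (wk K · ƛ (ƛ (tvar 1 · z))) · G) (barᵉ-renTm d (extST-extR (λ i → cong wk2 (p i))) t)
    trTᵉ-renTm d p (Lam t) G K = cong (λ z → ƛ (wk K · Λ z) · G) (barᵉ-renTm (suc d) (λ i → cong (λ z → renIT suc (wk z)) (p i)) t)
    trTᵉ-renTm d p (br c) G K = trCᵉ-renCmd d p c (plus G) K

    trLᵉ-renCo : ∀ d {e e' f} → (∀ i → e (f i) ≡ e' i) → ∀ l G K → trLᵉ d e (renCo f l) G K ≡ trLᵉ d e' l G K
    trLᵉ-renCo d p nil G K = refl
    trLᵉ-renCo d p (cons u l) G K =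
      cong₂ (λ z w → ƛ (tvar 0 · wk G · ƛ (tvar 0 · z · w)))
        (trLᵉ-renCo d (λ i → cong wk2 (p i)) l _ _) (barᵉ-renTm d (λ i → cong wk2 (p i)) u)
    trLᵉ-renCo d p (icns B l) G K =
      cong (λ z → ƛ (tvar 0 · wk G · ƛ (z · (tvar 0 ·I star d B)))) (trLᵉ-renCo d (λ i → cong wk2 (p i)) l _ _)
    trLᵉ-renCo d p (mu c) G K = cong ƛ (trCᵉ-renCmd d (extST-extR p) c _ _)

    trCᵉ-renCmd : ∀ d {e e' f} → (∀ i → e (f i) ≡ e' i) → ∀ c G K
        → trCᵉ d e (renCmd f c) G K ≡ trCᵉ d e' c G K
    trCᵉ-renCmd d p (cut t nil) G K = trTᵉ-renTm d p t G K
    trCᵉ-renCmd d {e} {e'} {f} p (cut t (cons u l)) G K =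
      trans (cong (λ z → trTᵉ d e (renTm f t) G z)
               (cong₂ (λ z w → ƛ (tvar 0 · z · w)) (trLᵉ-renCo d (λ i → cong wk (p i)) l _ _) (barᵉ-renTm d (λ i → cong wk (p i)) u)))
            (trTᵉ-renTm d p t G _)
    trCᵉ-renCmd d {e} {e'} {f} p (cut t (icns B l)) G K =
      trans (cong (λ z → trTᵉ d e (renTm f t) G (ƛ (z · (tvar 0 ·I star d B)))) (trLᵉ-renCo d (λ i → cong wk (p i)) l _ _))
            (trTᵉ-renTm d p t G _)
    trCᵉ-renCmd d p (cut t (mu c)) G K = cong₂ _·_ (trLᵉ-renCo d p (mu c) G K) (barᵉ-renTm d p t)

    barᵉ-renTm : ∀ d {e e' f} → (∀ i → e (f i) ≡ e' i) → ∀ t → barᵉ d e (renTm f t) ≡ barᵉ d e' t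
    barᵉ-renTm d p t = cong (λ z → ƛ (ƛ z)) (trTᵉ-renTm d (λ i → cong wk2 (p i)) t _ _)

  subT-s : ∀ σ → subT σ s ≡ s
  subT-s σ = subT-scoped-id s-closed (λ i ())

  subT-wkᵉ : ∀ {σ} {e e' : Env} → (∀ i → subT σ (e i) ≡ e' i) → ∀ i → subT (extST σ) (wk (e i)) ≡ wk (e' i)
  subT-wkᵉ {σ} {e} p i = trans (subT-ext-wk σ (e i)) (cong wk (p i))

  subT-wk2ᵉ : ∀ {σ} {e e' : Env} → (∀ i → subT σ (e i) ≡ e' i) → ∀ i
      → subT (extST (extST σ)) (wk2 (e i)) ≡ wk2 (e' i)
  subT-wk2ᵉ {σ} {e} p = subT-wkᵉ {extST σ} {λ i → wk (e i)} (subT-wkᵉ {σ} {e} p)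

  subT-extSTᵉ : ∀ {σ} {e e' : Env} → (∀ i → subT σ (e i) ≡ e' i) → ∀ i
      → subT (extST σ) (extST e i) ≡ extST e' i
  subT-extSTᵉ p zero = refl
  subT-extSTᵉ {σ} {e} p (suc i) = subT-wkᵉ {σ} {e} p i

  mutual
    subT-trTᵉ : ∀ d {σ} {e e' : Env} → (∀ i → subT σ (e i) ≡ e' i) → ∀ t G K
        → subT σ (trTᵉ d e t G K) ≡ trTᵉ d e' t (subT σ G) (subT σ K)
    subT-trTᵉ d {σ} p (var x) G K = cong₂ (λ z w → z · (w · subT σ G) · subT σ K) (p x) (subT-s σ)
    subT-trTᵉ d {σ} {e} {e'} p (lam t) G K =
      cong₂ (λ z w → ƛ (z · ƛ (ƛ (tvar 1 · w))) · subT σ G) (subT-ext-wk σ K)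
        (subT-barᵉ d {extST (extST (extST σ))} {extST (λ i → wk2 (e i))} (subT-extSTᵉ {extST (extST σ)} {λ i → wk2 (e i)} (subT-wk2ᵉ {σ} {e} p)) t)
    subT-trTᵉ d {σ} {e} {e'} p (Lam t) G K =
      cong₂ (λ z w → ƛ (z · Λ w) · subT σ G) (subT-ext-wk σ K)
        (subT-barᵉ (suc d) {λ i → renIT suc (extST σ i)} {λ i → renIT suc (wk (e i))} q t)
      where q : ∀ i → subT (λ i → renIT suc (extST σ i)) (renIT suc (wk (e i))) ≡ renIT suc (wk (e' i))
            q i = trans (sym (renIT-subT (λ _ → refl) (wk (e i)))) (cong (renIT suc) (subT-wkᵉ {σ} {e} p i))
    subT-trTᵉ d {σ} {e} {e'} p (br c) G K =
      trans (subT-trCᵉ d p c (plus G) K) (cong (λ z → trCᵉ d e' c (z · subT σ G) (subT σ K)) (subT-s σ))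

    subT-trLᵉ : ∀ d {σ} {e e' : Env} → (∀ i → subT σ (e i) ≡ e' i) → ∀ l G K
        → subT σ (trLᵉ d e l G K) ≡ trLᵉ d e' l (subT σ G) (subT σ K)
    subT-trLᵉ d {σ} p nil G K = cong₂ (λ z w → ƛ (tvar 0 · z · w)) (subT-ext-wk σ G) (subT-ext-wk σ K)
    subT-trLᵉ d {σ} {e} p (cons u l) G K =
      cong₂ (λ z w → ƛ (tvar 0 · z · ƛ w))
        (subT-ext-wk σ G)
        (cong₂ (λ x y → tvar 0 · x · y) (trans (subT-trLᵉ d {extST (extST σ)} {λ i → wk2 (e i)} (subT-wk2ᵉ {σ} {e} p) l (wk2 G) (wk2 K))
                          (cong₂ (trLᵉ d _ l) (subT-ext²-wk2 σ G) (subT-ext²-wk2 σ K)))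
                   (subT-barᵉ d {extST (extST σ)} {λ i → wk2 (e i)} (subT-wk2ᵉ {σ} {e} p) u))
    subT-trLᵉ d {σ} {e} p (icns B l) G K =
      cong₂ (λ z w → ƛ (tvar 0 · z · ƛ (w · (tvar 0 ·I star d B))))
        (subT-ext-wk σ G)
        (trans (subT-trLᵉ d {extST (extST σ)} {λ i → wk2 (e i)} (subT-wk2ᵉ {σ} {e} p) l (wk2 G) (wk2 K))
               (cong₂ (trLᵉ d _ l) (subT-ext²-wk2 σ G) (subT-ext²-wk2 σ K)))
    subT-trLᵉ d {σ} {e} p (mu c) G K =
      cong ƛ (trans (subT-trCᵉ d {extST σ} {extST e} (subT-extSTᵉ p) c (wk G) (wk K))
                    (cong₂ (trCᵉ d _ c) (subT-ext-wk σ G) (subT-ext-wk σ K)))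

    subT-trCᵉ : ∀ d {σ} {e e' : Env} → (∀ i → subT σ (e i) ≡ e' i) → ∀ c G K
        → subT σ (trCᵉ d e c G K) ≡ trCᵉ d e' c (subT σ G) (subT σ K)
    subT-trCᵉ d p (cut t nil) G K = subT-trTᵉ d p t G K
    subT-trCᵉ d {σ} {e} {e'} p (cut t (cons u l)) G K =
      trans (subT-trTᵉ d p t G _)
        (cong (trTᵉ d e' t (subT σ G))
          (cong₂ (λ z w → ƛ (tvar 0 · z · w))
            (trans (subT-trLᵉ d {extST σ} {λ i → wk (e i)} (subT-wkᵉ {σ} {e} p) l (wk G) (wk K))
                   (cong₂ (trLᵉ d _ l) (subT-ext-wk σ G) (subT-ext-wk σ K)))
            (subT-barᵉ d {extST σ} {λ i → wk (e i)} (subT-wkᵉ {σ} {e} p) u)))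
    subT-trCᵉ d {σ} {e} {e'} p (cut t (icns B l)) G K =
      trans (subT-trTᵉ d p t G _)
        (cong (trTᵉ d e' t (subT σ G))
          (cong (λ z → ƛ (z · (tvar 0 ·I star d B)))
            (trans (subT-trLᵉ d {extST σ} {λ i → wk (e i)} (subT-wkᵉ {σ} {e} p) l (wk G) (wk K))
                   (cong₂ (trLᵉ d _ l) (subT-ext-wk σ G) (subT-ext-wk σ K)))))
    subT-trCᵉ d p (cut t (mu c)) G K = cong₂ _·_ (subT-trLᵉ d p (mu c) G K) (subT-barᵉ d p t)

    subT-barᵉ : ∀ d {σ} {e e' : Env} → (∀ i → subT σ (e i) ≡ e' i) → ∀ t → subT σ (barᵉ d e t) ≡ barᵉ d e' t
    subT-barᵉ d {σ} {e} p t = cong (λ z → ƛ (ƛ z)) (subT-trTᵉ d {extST (extST σ)} {λ i → wk2 (e i)} (subT-wk2ᵉ {σ} {e} p) t _ _)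

  renT-trLᵉ : ∀ d {f} {e e' : Env} → (∀ i → renT f (e i) ≡ e' i) → ∀ l G K
      → renT f (trLᵉ d e l G K) ≡ trLᵉ d e' l (renT f G) (renT f K)
  renT-trLᵉ d {f} {e} {e'} p l G K =
    trans (sym (subT-var {λ i → tvar (f i)} {f} (λ _ → refl) (trLᵉ d e l G K)))
      (trans (subT-trLᵉ d {λ i → tvar (f i)} {e} {e'} (λ i → trans (subT-var (λ _ → refl) (e i)) (p i)) l G K)
             (cong₂ (trLᵉ d e' l) (subT-var (λ _ → refl) G) (subT-var (λ _ → refl) K)))
  renT-barᵉ : ∀ d {f} {e e' : Env} → (∀ i → renT f (e i) ≡ e' i) → ∀ t → renT f (barᵉ d e t) ≡ barᵉ d e' t
  renT-barᵉ d {f} {e} {e'} p t =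
    trans (sym (subT-var {λ i → tvar (f i)} {f} (λ _ → refl) (barᵉ d e t)))
      (subT-barᵉ d {λ i → tvar (f i)} {e} {e'} (λ i → trans (subT-var (λ _ → refl) (e i)) (p i)) t)

  subIT-s : ∀ τ → subIT τ s ≡ s
  subIT-s τ = subIT-scoped-id s-closed (λ i ())

  subIT-wk : ∀ τ X → subIT τ (wk X) ≡ wk (subIT τ X)
  subIT-wk τ X = sym (renT-subIT suc τ X)

  subIT-wk2 : ∀ τ X → subIT τ (wk2 X) ≡ wk2 (subIT τ X)
  subIT-wk2 τ X = trans (subIT-wk τ (wk X)) (cong wk (subIT-wk τ X))

  subIT-wkᵉ : ∀ {τ} {e e' : Env} → (∀ i → subIT τ (e i) ≡ e' i) → ∀ i → subIT τ (wk (e i)) ≡ wk (e' i)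
  subIT-wkᵉ {τ} {e} p i = trans (subIT-wk τ (e i)) (cong wk (p i))

  subIT-wk2ᵉ : ∀ {τ} {e e' : Env} → (∀ i → subIT τ (e i) ≡ e' i) → ∀ i → subIT τ (wk2 (e i)) ≡ wk2 (e' i)
  subIT-wk2ᵉ {τ} {e} p = subIT-wkᵉ {τ} {λ i → wk (e i)} (subIT-wkᵉ {τ} {e} p)

  subIT-extSTᵉ : ∀ {τ} {e e' : Env} → (∀ i → subIT τ (e i) ≡ e' i) → ∀ i → subIT τ (extST e i) ≡ extST e' i
  subIT-extSTᵉ p zero = refl
  subIT-extSTᵉ {τ} {e} p (suc i) = subIT-wkᵉ {τ} {e} p i

  mutual
    subIT-trTᵉ : ∀ d d' {τ τ'} {e e' : Env} → Shifts d d' τ' → StarOf d' τ τ'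
         → (∀ i → subIT τ (e i) ≡ e' i)
         → ∀ t G K → subIT τ (trTᵉ d e t G K) ≡ trTᵉ d' e' (subITm τ' t) (subIT τ G) (subIT τ K)
    subIT-trTᵉ d d' {τ} pd pτ p (var x) G K = cong₂ (λ z w → z · (w · subIT τ G) · subIT τ K) (p x) (subIT-s τ)
    subIT-trTᵉ d d' {τ} {τ'} {e} {e'} pd pτ p (lam t) G K =
      cong₂ (λ z w → ƛ (z · ƛ (ƛ (tvar 1 · w))) · subIT τ G) (subIT-wk τ K)
        (subIT-barᵉ d d' {τ} {τ'} {extST (λ i → wk2 (e i))} pd pτ (subIT-extSTᵉ {τ} {λ i → wk2 (e i)} (subIT-wk2ᵉ {τ} {e} p)) t)
    subIT-trTᵉ d d' {τ} {τ'} {e} {e'} pd pτ p (Lam t) G K =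
      cong₂ (λ z w → ƛ (z · Λ w) · subIT τ G) (subIT-wk τ K)
        (subIT-barᵉ (suc d) (suc d') {extSI τ} {extSI τ'} {λ i → renIT suc (wk (e i))}
          (Shifts-extSI pd) (StarOf-extSI pτ) q t)
      where q : ∀ i → subIT (extSI τ) (renIT suc (wk (e i))) ≡ renIT suc (wk (e' i))
            q i = trans (subIT-ext-renIT-suc τ (wk (e i))) (cong (renIT suc) (subIT-wkᵉ {τ} {e} p i))
    subIT-trTᵉ d d' {τ} {τ'} {e} {e'} pd pτ p (br c) G K =
      trans (subIT-trCᵉ d d' pd pτ p c (plus G) K) (cong (λ z → trCᵉ d' e' (subICmd τ' c) (z · subIT τ G) (subIT τ K)) (subIT-s τ))

    subIT-trLᵉ : ∀ d d' {τ τ'} {e e' : Env} → Shifts d d' τ' → StarOf d' τ τ'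
         → (∀ i → subIT τ (e i) ≡ e' i)
         → ∀ l G K → subIT τ (trLᵉ d e l G K) ≡ trLᵉ d' e' (subICo τ' l) (subIT τ G) (subIT τ K)
    subIT-trLᵉ d d' {τ} pd pτ p nil G K = cong₂ (λ z w → ƛ (tvar 0 · z · w)) (subIT-wk τ G) (subIT-wk τ K)
    subIT-trLᵉ d d' {τ} {τ'} {e} pd pτ p (cons u l) G K =
      cong₂ (λ z w → ƛ (tvar 0 · z · ƛ w)) (subIT-wk τ G)
        (cong₂ (λ x y → tvar 0 · x · y)
          (trans (subIT-trLᵉ d d' {τ} {τ'} {λ i → wk2 (e i)} pd pτ (subIT-wk2ᵉ {τ} {e} p) l (wk2 G) (wk2 K))
                 (cong₂ (trLᵉ d' _ (subICo τ' l)) (subIT-wk2 τ G) (subIT-wk2 τ K)))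
          (subIT-barᵉ d d' {τ} {τ'} {λ i → wk2 (e i)} pd pτ (subIT-wk2ᵉ {τ} {e} p) u))
    subIT-trLᵉ d d' {τ} {τ'} {e} pd pτ p (icns B l) G K =
      cong₂ (λ z w → ƛ (tvar 0 · z · ƛ w)) (subIT-wk τ G)
        (cong₂ (λ x y → x · (tvar 0 ·I y))
          (trans (subIT-trLᵉ d d' {τ} {τ'} {λ i → wk2 (e i)} pd pτ (subIT-wk2ᵉ {τ} {e} p) l (wk2 G) (wk2 K))
                 (cong₂ (trLᵉ d' _ (subICo τ' l)) (subIT-wk2 τ G) (subIT-wk2 τ K)))
          (subI-star pd pτ B))
    subIT-trLᵉ d d' {τ} {τ'} {e} pd pτ p (mu c) G K =
      cong ƛ (trans (subIT-trCᵉ d d' {τ} {τ'} {extST e} pd pτ (subIT-extSTᵉ {τ} {e} p) c (wk G) (wk K))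
                    (cong₂ (trCᵉ d' _ (subICmd τ' c)) (subIT-wk τ G) (subIT-wk τ K)))

    subIT-trCᵉ : ∀ d d' {τ τ'} {e e' : Env} → Shifts d d' τ' → StarOf d' τ τ'
         → (∀ i → subIT τ (e i) ≡ e' i)
         → ∀ c G K → subIT τ (trCᵉ d e c G K) ≡ trCᵉ d' e' (subICmd τ' c) (subIT τ G) (subIT τ K)
    subIT-trCᵉ d d' pd pτ p (cut t nil) G K = subIT-trTᵉ d d' pd pτ p t G K
    subIT-trCᵉ d d' {τ} {τ'} {e} {e'} pd pτ p (cut t (cons u l)) G K =
      trans (subIT-trTᵉ d d' pd pτ p t G _)
        (cong (trTᵉ d' e' (subITm τ' t) (subIT τ G))
          (cong₂ (λ z w → ƛ (tvar 0 · z · w))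
            (trans (subIT-trLᵉ d d' {τ} {τ'} {λ i → wk (e i)} pd pτ (subIT-wkᵉ {τ} {e} p) l (wk G) (wk K))
                   (cong₂ (trLᵉ d' _ (subICo τ' l)) (subIT-wk τ G) (subIT-wk τ K)))
            (subIT-barᵉ d d' {τ} {τ'} {λ i → wk (e i)} pd pτ (subIT-wkᵉ {τ} {e} p) u)))
    subIT-trCᵉ d d' {τ} {τ'} {e} {e'} pd pτ p (cut t (icns B l)) G K =
      trans (subIT-trTᵉ d d' pd pτ p t G _)
        (cong (trTᵉ d' e' (subITm τ' t) (subIT τ G))
          (cong₂ (λ z w → ƛ (z · (tvar 0 ·I w)))
            (trans (subIT-trLᵉ d d' {τ} {τ'} {λ i → wk (e i)} pd pτ (subIT-wkᵉ {τ} {e} p) l (wk G) (wk K))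
                   (cong₂ (trLᵉ d' _ (subICo τ' l)) (subIT-wk τ G) (subIT-wk τ K)))
            (subI-star pd pτ B)))
    subIT-trCᵉ d d' pd pτ p (cut t (mu c)) G K = cong₂ _·_ (subIT-trLᵉ d d' pd pτ p (mu c) G K) (subIT-barᵉ d d' pd pτ p t)

    subIT-barᵉ : ∀ d d' {τ τ'} {e e' : Env} → Shifts d d' τ' → StarOf d' τ τ'
         → (∀ i → subIT τ (e i) ≡ e' i)
         → ∀ t → subIT τ (barᵉ d e t) ≡ barᵉ d' e' (subITm τ' t)
    subIT-barᵉ d d' {τ} {τ'} {e} pd pτ p t =
      cong (λ z → ƛ (ƛ z)) (subIT-trTᵉ d d' {τ} {τ'} {λ i → wk2 (e i)} pd pτ (subIT-wk2ᵉ {τ} {e} p) t _ _)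

  renIT-barᵉ : ∀ d d' {f} {e e' : Env} → (∀ i → f (d + i) ≡ d' + i) → (∀ i → renIT f (e i) ≡ e' i)
             → ∀ t → renIT f (barᵉ d e t) ≡ barᵉ d' e' (renITm f t)
  renIT-barᵉ d d' {f} {e} {e'} pd p t = begin
    renIT f (barᵉ d e t)              ≡⟨ subIT-var (λ _ → refl) (barᵉ d e t) ⟨
    subIT ρ (barᵉ d e t)              ≡⟨ subIT-barᵉ d d' (shifts (λ i → cong ivar (pd i))) (starOf λ _ → refl) ρe≡e' t ⟩
    barᵉ d' e' (subITm ρ t)           ≡⟨ cong (barᵉ d' e') (subITm-var (λ _ → refl) t) ⟩
    barᵉ d' e' (renITm f t)           ∎
    where
      open ≡-Reasoning
      ρ : ℕ → Inh
      ρ i = ivar (f i)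
      ρe≡e' : ∀ i → subIT ρ (e i) ≡ e' i
      ρe≡e' i = trans (subIT-var (λ _ → refl) (e i)) (p i)

-- Simulation

module CGPS-Simulation (b : ℕ) (top : Inh) (s : TTm) (s-closed : ClosedT s) (s-step : ∀ G → s · G ⟶⁺ G) where
  open CGPS b top s
  open CGPSᵉ b top s
  open CGPS-Properties b top s s-closed

  barᵉ-apply : ∀ d e t G K → barᵉ d e t · G · K ⟶⁺ trTᵉ d e t G K
  barᵉ-apply d e t G K = ·ξ₁ β ∷ [ step≡ β eq ]
    where
      eq : subT (K •T) (subT (extST (G •T)) (trTᵉ d (λ i → wk2 (e i)) t (tvar 1) (tvar 0))) ≡ trTᵉ d e t G K
      eq = trans (cong (subT (K •T)) (subT-trTᵉ d {extST (G •T)} {λ i → wk2 (e i)} {λ i → wk (e i)} (λ i → subT-ext-•-wk2 G (e i)) t (tvar 1) (tvar 0)))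
             (trans (subT-trTᵉ d {K •T} {λ i → wk (e i)} {e} (λ i → subT-•-wk K (e i)) t (wk G) (tvar 0))
                    (cong (λ z → trTᵉ d e t z K) (subT-•-wk K G)))

  trLᵉ-apply : ∀ d e l t G K → trLᵉ d e l G K · barᵉ d e t ⟶* trCᵉ d e (cut t l) G K
  trLᵉ-apply d e nil t G K =
    step≡ β (cong₂ (λ z w → barᵉ d e t · z · w) (subT-•-wk _ G) (subT-•-wk _ K)) ◅ ⁺⇒* (barᵉ-apply d e t G K)
  trLᵉ-apply d e (cons u l) t G K =
    step≡ β (cong₂ (λ z w → barᵉ d e t · z · ƛ w) (subT-•-wk _ G)
               (cong₂ (λ x y → tvar 0 · x · y)
                 (trans (subT-trLᵉ d {extST (barᵉ d e t •T)} {λ i → wk2 (e i)} {λ i → wk (e i)} (λ i → subT-ext-•-wk2 _ (e i)) l (wk2 G) (wk2 K))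
                        (cong₂ (trLᵉ d _ l) (subT-ext-•-wk2 _ G) (subT-ext-•-wk2 _ K)))
                 (subT-barᵉ d {extST (barᵉ d e t •T)} {λ i → wk2 (e i)} {λ i → wk (e i)} (λ i → subT-ext-•-wk2 _ (e i)) u)))
      ◅ ⁺⇒* (barᵉ-apply d e t G _)
  trLᵉ-apply d e (icns B l) t G K =
    step≡ β (cong₂ (λ z w → barᵉ d e t · z · ƛ (w · (tvar 0 ·I star d B))) (subT-•-wk _ G)
                 (trans (subT-trLᵉ d {extST (barᵉ d e t •T)} {λ i → wk2 (e i)} {λ i → wk (e i)} (λ i → subT-ext-•-wk2 _ (e i)) l (wk2 G) (wk2 K))
                        (cong₂ (trLᵉ d _ l) (subT-ext-•-wk2 _ G) (subT-ext-•-wk2 _ K))))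
      ◅ ⁺⇒* (barᵉ-apply d e t G _)
  trLᵉ-apply d e (mu c) t G K = ∎*

  wk-⟶* : ∀ {x y} → x ⟶* y → wk x ⟶* wk y
  wk-⟶* = renT-⟶* suc
  wk-⟶⁺ : ∀ {x y} → x ⟶⁺ y → wk x ⟶⁺ wk y
  wk-⟶⁺ = renT-⟶⁺ suc

  mutual
    trTᵉ-mono-⟶* : ∀ d e t {G G' K K'} → G ⟶* G' → K ⟶* K' → trTᵉ d e t G K ⟶* trTᵉ d e t G' K'
    trTᵉ-mono-⟶* d e (var x) pG pK = ·* (·₂* _ (·₂* s pG)) pK
    trTᵉ-mono-⟶* d e (lam t) pG pK = ·* (ƛ* (·₁* _ (wk-⟶* pK))) pG
    trTᵉ-mono-⟶* d e (Lam t) pG pK = ·* (ƛ* (·₁* _ (wk-⟶* pK))) pG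
    trTᵉ-mono-⟶* d e (br c) pG pK = trCᵉ-mono-⟶* d e c (·₂* s pG) pK

    trLᵉ-mono-⟶* : ∀ d e l {G G' K K'} → G ⟶* G' → K ⟶* K' → trLᵉ d e l G K ⟶* trLᵉ d e l G' K'
    trLᵉ-mono-⟶* d e nil pG pK = ƛ* (·* (·₂* _ (wk-⟶* pG)) (wk-⟶* pK))
    trLᵉ-mono-⟶* d e (cons u l) pG pK =
      ƛ* (·* (·₂* _ (wk-⟶* pG)) (ƛ* (·₁* _ (·₂* _ (trLᵉ-mono-⟶* d _ l (wk-⟶* (wk-⟶* pG)) (wk-⟶* (wk-⟶* pK)))))))
    trLᵉ-mono-⟶* d e (icns B l) pG pK =
      ƛ* (·* (·₂* _ (wk-⟶* pG)) (ƛ* (·₁* _ (trLᵉ-mono-⟶* d _ l (wk-⟶* (wk-⟶* pG)) (wk-⟶* (wk-⟶* pK))))))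
    trLᵉ-mono-⟶* d e (mu c) pG pK = ƛ* (trCᵉ-mono-⟶* d _ c (wk-⟶* pG) (wk-⟶* pK))

    trCᵉ-mono-⟶* : ∀ d e c {G G' K K'} → G ⟶* G' → K ⟶* K' → trCᵉ d e c G K ⟶* trCᵉ d e c G' K'
    trCᵉ-mono-⟶* d e (cut t nil) pG pK = trTᵉ-mono-⟶* d e t pG pK
    trCᵉ-mono-⟶* d e (cut t (cons u l)) pG pK = trTᵉ-mono-⟶* d e t pG (ƛ* (·₁* _ (·₂* _ (trLᵉ-mono-⟶* d _ l (wk-⟶* pG) (wk-⟶* pK)))))
    trCᵉ-mono-⟶* d e (cut t (icns B l)) pG pK = trTᵉ-mono-⟶* d e t pG (ƛ* (·₁* _ (trLᵉ-mono-⟶* d _ l (wk-⟶* pG) (wk-⟶* pK))))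
    trCᵉ-mono-⟶* d e (cut t (mu c)) pG pK = ·₁* _ (trLᵉ-mono-⟶* d e (mu c) pG pK)

  mutual
    trTᵉ-monoˡ-⟶⁺ : ∀ d e t {G G'} K → G ⟶⁺ G' → trTᵉ d e t G K ⟶⁺ trTᵉ d e t G' K
    trTᵉ-monoˡ-⟶⁺ d e (var x) K p = ·₁⁺ K (·₂⁺ _ (·₂⁺ s p))
    trTᵉ-monoˡ-⟶⁺ d e (lam t) K p = ·₂⁺ _ p
    trTᵉ-monoˡ-⟶⁺ d e (Lam t) K p = ·₂⁺ _ p
    trTᵉ-monoˡ-⟶⁺ d e (br c) K p = trCᵉ-monoˡ-⟶⁺ d e c K (·₂⁺ s p)

    trLᵉ-monoˡ-⟶⁺ : ∀ d e l {G G'} K → G ⟶⁺ G' → trLᵉ d e l G K ⟶⁺ trLᵉ d e l G' K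
    trLᵉ-monoˡ-⟶⁺ d e nil K p = ƛ⁺ (·₁⁺ _ (·₂⁺ _ (wk-⟶⁺ p)))
    trLᵉ-monoˡ-⟶⁺ d e (cons u l) K p =
      ƛ⁺ (·₁⁺ _ (·₂⁺ _ (wk-⟶⁺ p)) ⁺◅* ·₂* _ (ƛ* (·₁* _ (·₂* _ (trLᵉ-mono-⟶* d _ l (wk-⟶* (wk-⟶* (⁺⇒* p))) ∎*)))))
    trLᵉ-monoˡ-⟶⁺ d e (icns B l) K p =
      ƛ⁺ (·₁⁺ _ (·₂⁺ _ (wk-⟶⁺ p)) ⁺◅* ·₂* _ (ƛ* (·₁* _ (trLᵉ-mono-⟶* d _ l (wk-⟶* (wk-⟶* (⁺⇒* p))) ∎*))))
    trLᵉ-monoˡ-⟶⁺ d e (mu c) K p = ƛ⁺ (trCᵉ-monoˡ-⟶⁺ d _ c _ (wk-⟶⁺ p))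

    trCᵉ-monoˡ-⟶⁺ : ∀ d e c {G G'} K → G ⟶⁺ G' → trCᵉ d e c G K ⟶⁺ trCᵉ d e c G' K
    trCᵉ-monoˡ-⟶⁺ d e (cut t nil) K p = trTᵉ-monoˡ-⟶⁺ d e t K p
    trCᵉ-monoˡ-⟶⁺ d e (cut t (cons u l)) K p =
      trTᵉ-monoˡ-⟶⁺ d e t _ p ⁺◅* trTᵉ-mono-⟶* d e t ∎* (ƛ* (·₁* _ (·₂* _ (trLᵉ-mono-⟶* d _ l (wk-⟶* (⁺⇒* p)) ∎*))))
    trCᵉ-monoˡ-⟶⁺ d e (cut t (icns B l)) K p =
      trTᵉ-monoˡ-⟶⁺ d e t _ p ⁺◅* trTᵉ-mono-⟶* d e t ∎* (ƛ* (·₁* _ (trLᵉ-mono-⟶* d _ l (wk-⟶* (⁺⇒* p)) ∎*)))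
    trCᵉ-monoˡ-⟶⁺ d e (cut t (mu c)) K p = ·₁⁺ _ (trLᵉ-monoˡ-⟶⁺ d e (mu c) K p)

  mutual
    trTᵉ-monoʳ-⟶⁺ : ∀ d e t G {K K'} → K ⟶⁺ K' → trTᵉ d e t G K ⟶⁺ trTᵉ d e t G K'
    trTᵉ-monoʳ-⟶⁺ d e (var x) G p = ·₂⁺ _ p
    trTᵉ-monoʳ-⟶⁺ d e (lam t) G p = ·₁⁺ G (ƛ⁺ (·₁⁺ _ (wk-⟶⁺ p)))
    trTᵉ-monoʳ-⟶⁺ d e (Lam t) G p = ·₁⁺ G (ƛ⁺ (·₁⁺ _ (wk-⟶⁺ p)))
    trTᵉ-monoʳ-⟶⁺ d e (br c) G p = trCᵉ-monoʳ-⟶⁺ d e c _ p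

    trLᵉ-monoʳ-⟶⁺ : ∀ d e l G {K K'} → K ⟶⁺ K' → trLᵉ d e l G K ⟶⁺ trLᵉ d e l G K'
    trLᵉ-monoʳ-⟶⁺ d e nil G p = ƛ⁺ (·₂⁺ _ (wk-⟶⁺ p))
    trLᵉ-monoʳ-⟶⁺ d e (cons u l) G p = ƛ⁺ (·₂⁺ _ (ƛ⁺ (·₁⁺ _ (·₂⁺ _ (trLᵉ-monoʳ-⟶⁺ d _ l _ (wk-⟶⁺ (wk-⟶⁺ p)))))))
    trLᵉ-monoʳ-⟶⁺ d e (icns B l) G p = ƛ⁺ (·₂⁺ _ (ƛ⁺ (·₁⁺ _ (trLᵉ-monoʳ-⟶⁺ d _ l _ (wk-⟶⁺ (wk-⟶⁺ p))))))
    trLᵉ-monoʳ-⟶⁺ d e (mu c) G p = ƛ⁺ (trCᵉ-monoʳ-⟶⁺ d _ c _ (wk-⟶⁺ p))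

    trCᵉ-monoʳ-⟶⁺ : ∀ d e c G {K K'} → K ⟶⁺ K' → trCᵉ d e c G K ⟶⁺ trCᵉ d e c G K'
    trCᵉ-monoʳ-⟶⁺ d e (cut t nil) G p = trTᵉ-monoʳ-⟶⁺ d e t G p
    trCᵉ-monoʳ-⟶⁺ d e (cut t (cons u l)) G p = trTᵉ-monoʳ-⟶⁺ d e t G (ƛ⁺ (·₁⁺ _ (·₂⁺ _ (trLᵉ-monoʳ-⟶⁺ d _ l _ (wk-⟶⁺ p)))))
    trCᵉ-monoʳ-⟶⁺ d e (cut t (icns B l)) G p = trTᵉ-monoʳ-⟶⁺ d e t G (ƛ⁺ (·₁⁺ _ (trLᵉ-monoʳ-⟶⁺ d _ l _ (wk-⟶⁺ p))))
    trCᵉ-monoʳ-⟶⁺ d e (cut t (mu c)) G p = ·₁⁺ _ (trLᵉ-monoʳ-⟶⁺ d e (mu c) G p)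

  -- The translation commutes with a source substitution σ only up to reduction: a variable x is
  -- translated as x G⁺ K, and substituting the bar of σ x for x gives a term that merely reduces
  -- to (σ x : G, K), via (σ x : G⁺, K) and s G →⁺ G.
  Realises : ℕ → Env → (ℕ → Tm) → Env → Set
  Realises d e σ e' = ∀ i → (∃[ j ] σ i ≡ var j × e i ≡ e' j) ⊎ (e i ⟶* barᵉ d e' (σ i))

  Realises-renT : ∀ {d e σ e'} f → Realises d e σ e' → Realises d (λ i → renT f (e i)) σ (λ i → renT f (e' i))
  Realises-renT {d} {e} {σ} {e'} f r i with r i
  ... | inj₁ (j , a , c) = inj₁ (j , a , cong (renT f) c)
  ... | inj₂ q = inj₂ (renT-⟶* f q ◅◅ ≡⇒* (renT-barᵉ d {f} {e'} (λ _ → refl) (σ i)))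

  Realises-wk2 : ∀ {d e σ e'} → Realises d e σ e' → Realises d (λ i → wk2 (e i)) σ (λ i → wk2 (e' i))
  Realises-wk2 r = Realises-renT suc (Realises-renT suc r)

  Realises-ext : ∀ {d e σ e'} → Realises d e σ e' → Realises d (extST e) (extS σ) (extST e')
  Realises-ext r zero = inj₁ (zero , refl , refl)
  Realises-ext {d} {e} {σ} {e'} r (suc i) with r i
  ... | inj₁ (j , a , c) = inj₁ (suc j , cong (renTm suc) a , cong wk c)
  ... | inj₂ q = inj₂ (wk-⟶* q ◅◅ ≡⇒* (trans (renT-barᵉ d {suc} {e'} {λ i → wk (e' i)} (λ _ → refl) (σ i))
                                       (sym (barᵉ-renTm d {extST e'} {λ i → wk (e' i)} {suc} (λ _ → refl) (σ i)))))

  Realises-Lam : ∀ {d e σ e'} → Realises d e σ e' → Realises (suc d) (λ i → renIT suc (e i)) (λ i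
      → renITm suc (σ i)) (λ i → renIT suc (e' i))
  Realises-Lam {d} {e} {σ} {e'} r i with r i
  ... | inj₁ (j , a , c) = inj₁ (j , cong (renITm suc) a , cong (renIT suc) c)
  ... | inj₂ q = inj₂ (renIT-⟶* suc q ◅◅ ≡⇒* (renIT-barᵉ d (suc d) {suc} {e'} (λ _ → refl) (λ _ → refl) (σ i)))

  mutual
    trTᵉ-subTm : ∀ d {e σ e'} → Realises d e σ e' → ∀ t G K → trTᵉ d e t G K ⟶* trTᵉ d e' (subTm σ t) G K
    trTᵉ-subTm d {e} {σ} {e'} r (var x) G K with r x
    ... | inj₁ (j , a , c) = ≡⇒* (trans (cong (λ z → z · plus G · K) c) (cong (λ z → trTᵉ d e' z G K) (sym a)))
    ... | inj₂ q =
      ·₁* K (·₁* (plus G) q)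
        ◅◅ ⁺⇒* (barᵉ-apply d e' (σ x) (plus G) K)
        ◅◅ ⁺⇒* (trTᵉ-monoˡ-⟶⁺ d e' (σ x) K (s-step G))
    trTᵉ-subTm d r (lam t) G K = ·₁* G (ƛ* (·₂* _ (ƛ* (ƛ* (·₂* _ (barᵉ-subTm d (Realises-ext (Realises-wk2 r)) t))))))
    trTᵉ-subTm d r (Lam t) G K = ·₁* G (ƛ* (·₂* _ (Λ* (barᵉ-subTm (suc d) (Realises-Lam (Realises-renT suc r)) t))))
    trTᵉ-subTm d r (br c) G K = trCᵉ-subCmd d r c (plus G) K

    trLᵉ-subCo : ∀ d {e σ e'} → Realises d e σ e' → ∀ l G K → trLᵉ d e l G K ⟶* trLᵉ d e' (subCo σ l) G K
    trLᵉ-subCo d r nil G K = ∎*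
    trLᵉ-subCo d r (cons u l) G K = ƛ* (·₂* _ (ƛ* (·* (·₂* _ (trLᵉ-subCo d (Realises-wk2 r) l _ _)) (barᵉ-subTm d (Realises-wk2 r) u))))
    trLᵉ-subCo d r (icns B l) G K = ƛ* (·₂* _ (ƛ* (·₁* _ (trLᵉ-subCo d (Realises-wk2 r) l _ _))))
    trLᵉ-subCo d r (mu c) G K = ƛ* (trCᵉ-subCmd d (Realises-ext r) c _ _)

    trCᵉ-subCmd : ∀ d {e σ e'} → Realises d e σ e' → ∀ c G K → trCᵉ d e c G K ⟶* trCᵉ d e' (subCmd σ c) G K
    trCᵉ-subCmd d r (cut t nil) G K = trTᵉ-subTm d r t G K
    trCᵉ-subCmd d {σ = σ} {e' = e'} r (cut t (cons u l)) G K =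
      trTᵉ-subTm d r t G _
        ◅◅ trTᵉ-mono-⟶* d e' (subTm σ t) ∎*
             (ƛ* (·* (·₂* _ (trLᵉ-subCo d (Realises-renT suc r) l _ _)) (barᵉ-subTm d (Realises-renT suc r) u)))
    trCᵉ-subCmd d {σ = σ} {e' = e'} r (cut t (icns B l)) G K =
      trTᵉ-subTm d r t G _ ◅◅ trTᵉ-mono-⟶* d e' (subTm σ t) ∎* (ƛ* (·₁* _ (trLᵉ-subCo d (Realises-renT suc r) l _ _)))
    trCᵉ-subCmd d r (cut t (mu c)) G K = ·* (trLᵉ-subCo d r (mu c) G K) (barᵉ-subTm d r t)

    barᵉ-subTm : ∀ d {e σ e'} → Realises d e σ e' → ∀ t → barᵉ d e t ⟶* barᵉ d e' (subTm σ t)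
    barᵉ-subTm d r t = ƛ* (ƛ* (trTᵉ-subTm d (Realises-wk2 r) t _ _))

  -- The continuation contributed by an evaluation context E: (t E : G, K) = (t : G, evCont E G K).
  evCont : ℕ → Env → CoTm → TTm → TTm → TTm
  evCont d e nil G K = K
  evCont d e (cons u l) G K = ƛ (tvar 0 · trLᵉ d (λ i → wk (e i)) l (wk G) (wk K) · barᵉ d (λ i → wk (e i)) u)
  evCont d e (icns B l) G K = ƛ (trLᵉ d (λ i → wk (e i)) l (wk G) (wk K) · (tvar 0 ·I star d B))
  evCont d e (mu c) G K = K

  renT-evCont : ∀ d {f} {e e' : Env} → (∀ i → renT f (e i) ≡ e' i) → ∀ E G K
      → renT f (evCont d e E G K) ≡ evCont d e' E (renT f G) (renT f K)
  renT-evCont d p nil G K = refl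
  renT-evCont d {f} {e} p (cons u l) G K =
    cong ƛ (cong₂ (λ x y → tvar 0 · x · y)
      (trans (renT-trLᵉ d {extR f} {λ i → wk (e i)} (λ i → trans (renT-ext-wk f (e i)) (cong wk (p i))) l (wk G) (wk K))
             (cong₂ (trLᵉ d _ l) (renT-ext-wk f G) (renT-ext-wk f K)))
      (renT-barᵉ d {extR f} {λ i → wk (e i)} (λ i → trans (renT-ext-wk f (e i)) (cong wk (p i))) u))
  renT-evCont d {f} {e} p (icns B l) G K =
    cong ƛ (cong (λ x → x · (tvar 0 ·I star d B))
      (trans (renT-trLᵉ d {extR f} {λ i → wk (e i)} (λ i → trans (renT-ext-wk f (e i)) (cong wk (p i))) l (wk G) (wk K))
             (cong₂ (trLᵉ d _ l) (renT-ext-wk f G) (renT-ext-wk f K))))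
  renT-evCont d p (mu c) G K = refl

  wk-evCont : ∀ d e E G K → wk (evCont d e E G K) ≡ evCont d (λ i → wk (e i)) E (wk G) (wk K)
  wk-evCont d e E G K = renT-evCont d {suc} {e} (λ _ → refl) E G K

  wk2-evCont : ∀ d e E G K → wk2 (evCont d e E G K) ≡ evCont d (λ i → wk2 (e i)) E (wk2 G) (wk2 K)
  wk2-evCont d e E G K = trans (cong wk (wk-evCont d e E G K)) (wk-evCont d (λ i → wk (e i)) E (wk G) (wk K))

  evCont-renCo : ∀ d {e e' : Env} {g} → (∀ i → e (g i) ≡ e' i) → ∀ E G K
      → evCont d e (renCo g E) G K ≡ evCont d e' E G K
  evCont-renCo d p nil G K = refl
  evCont-renCo d p (cons u l) G K =
    cong ƛ (cong₂ (λ x y → tvar 0 · x · y) (trLᵉ-renCo d (λ i → cong wk (p i)) l _ _) (barᵉ-renTm d (λ i → cong wk (p i)) u))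
  evCont-renCo d p (icns B l) G K =
    cong ƛ (cong (λ x → x · (tvar 0 ·I star d B)) (trLᵉ-renCo d (λ i → cong wk (p i)) l _ _))
  evCont-renCo d p (mu c) G K = refl

  mutual
    trLᵉ-++ : ∀ {E} → EvCtx E → ∀ d e l G K → trLᵉ d e (l ++ E) G K ≡ trLᵉ d e l G (evCont d e E G K)
    trLᵉ-++ ev-nil d e nil G K = refl
    trLᵉ-++ {E} ev-cons d e nil G K = cong (λ z → ƛ (tvar 0 · wk G · z)) (sym (wk-evCont d e E G K))
    trLᵉ-++ {E} ev-icns d e nil G K = cong (λ z → ƛ (tvar 0 · wk G · z)) (sym (wk-evCont d e E G K))
    trLᵉ-++ {E} ev d e (cons u l) G K =
      cong (λ z → ƛ (tvar 0 · wk G · ƛ (tvar 0 · z · barᵉ d (λ i → wk2 (e i)) u)))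
        (trans (trLᵉ-++ ev d _ l (wk2 G) (wk2 K)) (cong (trLᵉ d _ l (wk2 G)) (sym (wk2-evCont d e E G K))))
    trLᵉ-++ {E} ev d e (icns B l) G K =
      cong (λ z → ƛ (tvar 0 · wk G · ƛ (z · (tvar 0 ·I star d B))))
        (trans (trLᵉ-++ ev d _ l (wk2 G) (wk2 K)) (cong (trLᵉ d _ l (wk2 G)) (sym (wk2-evCont d e E G K))))
    trLᵉ-++ {E} ev d e (mu (cut t l)) G K =
      cong ƛ (trans (trCᵉ-++ (EvCtx-renCo suc ev) d (extST e) t l (wk G) (wk K))
        (cong (trCᵉ d (extST e) (cut t l) (wk G))
          (trans (evCont-renCo d {extST e} {λ i → wk (e i)} {suc} (λ _ → refl) E (wk G) (wk K)) (sym (wk-evCont d e E G K)))))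

    trCᵉ-++ : ∀ {E} → EvCtx E → ∀ d e t l G K
        → trCᵉ d e (cut t (l ++ E)) G K ≡ trCᵉ d e (cut t l) G (evCont d e E G K)
    trCᵉ-++ ev-nil d e t nil G K = refl
    trCᵉ-++ ev-cons d e t nil G K = refl
    trCᵉ-++ ev-icns d e t nil G K = refl
    trCᵉ-++ {E} ev d e t (cons u l) G K =
      cong (λ z → trTᵉ d e t G (ƛ (tvar 0 · z · barᵉ d (λ i → wk (e i)) u)))
        (trans (trLᵉ-++ ev d _ l (wk G) (wk K)) (cong (trLᵉ d _ l (wk G)) (sym (wk-evCont d e E G K))))
    trCᵉ-++ {E} ev d e t (icns B l) G K =
      cong (λ z → trTᵉ d e t G (ƛ (z · (tvar 0 ·I star d B))))
        (trans (trLᵉ-++ ev d _ l (wk G) (wk K)) (cong (trLᵉ d _ l (wk G)) (sym (wk-evCont d e E G K))))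
    trCᵉ-++ ev d e t (mu (cut t' l')) G K = cong (_· barᵉ d e t) (trLᵉ-++ ev d e (mu (cut t' l')) G K)

  trCᵉ-π-redex : ∀ {E} → EvCtx E → ∀ d e t l G K
      → trCᵉ d e (cut (br (cut t l)) E) G K ≡ trCᵉ d e (cut t l) (plus G) (evCont d e E G K)
  trCᵉ-π-redex ev-nil d e t l G K = refl
  trCᵉ-π-redex ev-cons d e t l G K = refl
  trCᵉ-π-redex ev-icns d e t l G K = refl

  simulate-μ : ∀ d e l G K → trLᵉ d e (mu (cut (var zero) (renCo suc l))) G K ⟶⁺ trLᵉ d e l G K
  simulate-μ d e nil G K = ƛ⁺ (·₁⁺ _ (·₂⁺ _ (s-step (wk G))))
  simulate-μ d e (cons u l) G K =
    ƛ⁺ (·₁⁺ _ (·₂⁺ _ (s-step (wk G))))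
      ⁺◅* ≡⇒* (cong (λ z → ƛ (tvar 0 · wk G · ƛ z))
               (cong₂ (λ x y → tvar 0 · x · y) (trLᵉ-renCo d (λ _ → refl) l _ _) (barᵉ-renTm d (λ _ → refl) u)))
  simulate-μ d e (icns B l) G K =
    ƛ⁺ (·₁⁺ _ (·₂⁺ _ (s-step (wk G))))
      ⁺◅* ≡⇒* (cong (λ z → ƛ (tvar 0 · wk G · ƛ (z · (tvar 0 ·I star d B)))) (trLᵉ-renCo d (λ _ → refl) l _ _))
  simulate-μ d e (mu c) G K =
    [ ƛξ (step≡ β body≡) ]
      ⁺◅* ƛ* (trCᵉ-subCmd d r c (wk G) (wk K)
               ◅◅ ≡⇒* (cong (λ z → trCᵉ d (extST e) z (wk G) (wk K)) (subCmd-id (λ _ → refl) c)))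
    where
      X = barᵉ d (extST e) (var zero)
      e₂ : Env
      e₂ i = subT (X •T) (extST (extST e) i)
      e₁ : Env
      e₁ i = e₂ (extR suc i)
      body≡ : subT (X •T) (trCᵉ d (extST (extST e)) (renCmd (extR suc) c) (wk (wk G)) (wk (wk K))) ≡ trCᵉ d e₁ c (wk G) (wk K)
      body≡ = trans (subT-trCᵉ d {X •T} {extST (extST e)} {e₂} (λ _ → refl) (renCmd (extR suc) c) (wk (wk G)) (wk (wk K)))
                (trans (cong₂ (trCᵉ d e₂ (renCmd (extR suc) c)) (subT-•-wk X (wk G)) (subT-•-wk X (wk K)))
                       (trCᵉ-renCmd d {e₂} {e₁} {extR suc} (λ _ → refl) c (wk G) (wk K)))
      r : Realises d e₁ var (extST e)
      r zero    = inj₂ ∎*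
      r (suc i) = inj₁ (suc i , refl , subT-•-wk X (wk (e i)))

  simulate-β₁ : ∀ d e t u l G K → trCᵉ d e (cut (lam t) (cons u l)) G K ⟶⁺ trCᵉ d e (cut u (mu (cut t (renCo suc l)))) G K
  simulate-β₁ d e t u l G K =
    step≡ β eq1 ∷ step≡ β eq2 ∷ [ ·ξ₁ (step≡ β eq3) ]
      ⁺◅* (≡⇒* (cong (λ z → ƛ (z · barᵉ d (extST e) t) · U) eqL)
           ◅◅ ·₁* U (ƛ* (trLᵉ-apply d (extST e) (renCo suc l) t (wk G) (wk K))))
    where
      L1 = trLᵉ d (λ i → wk (e i)) l (wk G) (wk K)
      U1 = barᵉ d (λ i → wk (e i)) u
      K1 = ƛ (tvar 0 · L1 · U1)
      W = ƛ (ƛ (tvar 1 · barᵉ d (extST (λ i → wk2 (e i))) t))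
      W' = ƛ (ƛ (tvar 1 · barᵉ d (extST (λ i → wk (e i))) t))
      L = trLᵉ d e l G K
      U = barᵉ d e u
      eq1 : subT (G •T) (wk K1 · W) ≡ K1 · W'
      eq1 = cong₂ _·_ (subT-•-wk G K1)
              (cong (λ z → ƛ (ƛ (tvar 1 · z)))
                (subT-barᵉ d {extST (extST (G •T))} {extST (λ i → wk2 (e i))} {extST (λ i → wk (e i))}
                  (subT-extSTᵉ {extST (G •T)} {λ i → wk2 (e i)} {λ i → wk (e i)} (λ i → subT-ext-•-wk2 G (e i))) t))
      eq2 : subT (W' •T) (tvar 0 · L1 · U1) ≡ W' · L · U
      eq2 = cong₂ (λ x y → W' · x · y)
              (trans (subT-trLᵉ d {W' •T} {λ i → wk (e i)} {e} (λ i → subT-•-wk W' (e i)) l (wk G) (wk K))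
                     (cong₂ (trLᵉ d e l) (subT-•-wk W' G) (subT-•-wk W' K)))
              (subT-barᵉ d {W' •T} {λ i → wk (e i)} {e} (λ i → subT-•-wk W' (e i)) u)
      eq3 : subT (L •T) (ƛ (tvar 1 · barᵉ d (extST (λ i → wk (e i))) t)) ≡ ƛ (wk L · barᵉ d (extST e) t)
      eq3 = cong (λ z → ƛ (wk L · z))
              (subT-barᵉ d {extST (L •T)} {extST (λ i → wk (e i))} {extST e}
                (subT-extSTᵉ {L •T} {λ i → wk (e i)} {e} (λ i → subT-•-wk L (e i))) t)
      eqL : wk L ≡ trLᵉ d (extST e) (renCo suc l) (wk G) (wk K)
      eqL = trans (renT-trLᵉ d {suc} {e} {λ i → wk (e i)} (λ _ → refl) l G K)
                  (sym (trLᵉ-renCo d {extST e} {λ i → wk (e i)} {suc} (λ _ → refl) l (wk G) (wk K)))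

  simulate-β₂ : ∀ d e t B l G K → trCᵉ d e (cut (Lam t) (icns B l)) G K ⟶⁺ trCᵉ d e (cut (subITm (B •I) t) l) G K
  simulate-β₂ d e t B l G K =
    step≡ β eq1 ∷ step≡ β eq2 ∷ [ ·ξ₂ (step≡ βΛ eq3) ] ⁺◅* trLᵉ-apply d e l (subITm (B •I) t) G K
    where
      K1 = ƛ (trLᵉ d (λ i → wk (e i)) l (wk G) (wk K) · (tvar 0 ·I star d B))
      X' = barᵉ (suc d) (λ i → renIT suc (e i)) t
      eq1 : subT (G •T) (wk K1 · Λ (barᵉ (suc d) (λ i → renIT suc (wk (e i))) t)) ≡ K1 · Λ X'
      eq1 = cong₂ _·_ (subT-•-wk G K1)
              (cong Λ (subT-barᵉ (suc d) {λ i → renIT suc ((G •T) i)} {λ i → renIT suc (wk (e i))} {λ i → renIT suc (e i)}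
                (λ i → trans (sym (renIT-subT (λ _ → refl) (wk (e i)))) (cong (renIT suc) (subT-•-wk G (e i)))) t))
      eq2 : subT (Λ X' •T) (trLᵉ d (λ i → wk (e i)) l (wk G) (wk K) · (tvar 0 ·I star d B)) ≡ trLᵉ d e l G K · (Λ X' ·I star d B)
      eq2 = cong (_· (Λ X' ·I star d B))
              (trans (subT-trLᵉ d {Λ X' •T} {λ i → wk (e i)} {e} (λ i → subT-•-wk (Λ X') (e i)) l (wk G) (wk K))
                     (cong₂ (trLᵉ d e l) (subT-•-wk (Λ X') G) (subT-•-wk (Λ X') K)))
      eq3 : subIT (star d B •I) X' ≡ barᵉ d e (subITm (B •I) t)
      eq3 = subIT-barᵉ (suc d) d {star d B •I} {B •I} {λ i → renIT suc (e i)} {e} (shifts λ _ → refl) (StarOf-• d B)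
              (λ i → subIT-•-renIT (star d B) (e i)) t

  simulate-π : ∀ {E} → EvCtx E → ∀ d e t l G K
      → trCᵉ d e (cut (br (cut t l)) E) G K ⟶⁺ trCᵉ d e (cut t (l ++ E)) G K
  simulate-π ev d e t l G K =
    ≡⁺≡ (trCᵉ-π-redex ev d e t l G K) (trCᵉ-monoˡ-⟶⁺ d e (cut t l) _ (s-step G)) (sym (trCᵉ-++ ev d e t l G K))

  simulate-σ : ∀ d e t c G K → trCᵉ d e (cut t (mu c)) G K ⟶⁺ trCᵉ d e (subCmd (t •_) c) G K
  simulate-σ d e t c G K = [ step≡ β body≡ ] ⁺◅* trCᵉ-subCmd d r c G K
    where
      X = barᵉ d e t
      e₁ : Env
      e₁ i = subT (X •T) (extST e i)
      body≡ : subT (X •T) (trCᵉ d (extST e) c (wk G) (wk K)) ≡ trCᵉ d e₁ c G K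
      body≡ = trans (subT-trCᵉ d {X •T} {extST e} {e₁} (λ _ → refl) c (wk G) (wk K))
                    (cong₂ (trCᵉ d e₁ c) (subT-•-wk X G) (subT-•-wk X K))
      r : Realises d e₁ (t •_) e
      r zero    = inj₂ ∎*
      r (suc i) = inj₁ (i , refl , subT-•-wk X (e i))

  mutual
    simulateT : ∀ {t t'} → t ⟶t t' → ∀ d e G K → trTᵉ d e t G K ⟶⁺ trTᵉ d e t' G K
    simulateT (ε {t})  d e G K = trTᵉ-monoˡ-⟶⁺ d e t K (s-step G)
    simulateT (lamξ p) d e G K = ·₁⁺ G (ƛ⁺ (·₂⁺ _ (ƛ⁺ (ƛ⁺ (·₂⁺ _ (simulateBar p d _))))))
    simulateT (Lamξ p) d e G K = ·₁⁺ G (ƛ⁺ (·₂⁺ _ (Λ⁺ (simulateBar p (suc d) _))))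
    simulateT (brξ p)  d e G K = simulateC p d e (plus G) K

    simulateBar : ∀ {t t'} → t ⟶t t' → ∀ d e → barᵉ d e t ⟶⁺ barᵉ d e t'
    simulateBar p d e = ƛ⁺ (ƛ⁺ (simulateT p d _ _ _))

    simulateL : ∀ {l l'} → l ⟶l l' → ∀ d e G K → trLᵉ d e l G K ⟶⁺ trLᵉ d e l' G K
    simulateL (μ {l})    d e G K = simulate-μ d e l G K
    simulateL (consξ₁ p) d e G K = ƛ⁺ (·₂⁺ _ (ƛ⁺ (·₂⁺ _ (simulateBar p d _))))
    simulateL (consξ₂ p) d e G K = ƛ⁺ (·₂⁺ _ (ƛ⁺ (·₁⁺ _ (·₂⁺ _ (simulateL p d _ _ _)))))
    simulateL (icnsξ₁ p) d e G K = ƛ⁺ (·₂⁺ _ (ƛ⁺ (·₂⁺ _ [ ·Iβ₀ (star-⟶₀ d p) ])))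
    simulateL (icnsξ₂ p) d e G K = ƛ⁺ (·₂⁺ _ (ƛ⁺ (·₁⁺ _ (simulateL p d _ _ _))))
    simulateL (muξ p)    d e G K = ƛ⁺ (simulateC p d (extST e) _ _)

    simulateC : ∀ {c c'} → c ⟶c c' → ∀ d e G K → trCᵉ d e c G K ⟶⁺ trCᵉ d e c' G K
    simulateC (β₁ {t} {u} {l})  d e G K = simulate-β₁ d e t u l G K
    simulateC (β₂ {t} {B} {l})  d e G K = simulate-β₂ d e t B l G K
    simulateC (π {t} {l} ev)    d e G K = simulate-π ev d e t l G K
    simulateC (σ′ {t} {c})      d e G K = simulate-σ d e t c G K
    simulateC (cutξ₁ {l = nil} p)      d e G K = simulateT p d e G K
    simulateC (cutξ₁ {l = cons u l} p) d e G K = simulateT p d e G _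
    simulateC (cutξ₁ {l = icns B l} p) d e G K = simulateT p d e G _
    simulateC (cutξ₁ {l = mu c} p)     d e G K = ·₂⁺ _ (simulateBar p d e)
    simulateC (cutξ₂ {l = nil} ())
    simulateC (cutξ₂ {t = t} (consξ₁ p)) d e G K = trTᵉ-monoʳ-⟶⁺ d e t G (ƛ⁺ (·₂⁺ _ (simulateBar p d _)))
    simulateC (cutξ₂ {t = t} (consξ₂ p)) d e G K = trTᵉ-monoʳ-⟶⁺ d e t G (ƛ⁺ (·₁⁺ _ (·₂⁺ _ (simulateL p d _ _ _))))
    simulateC (cutξ₂ {t = t} (icnsξ₁ p)) d e G K = trTᵉ-monoʳ-⟶⁺ d e t G (ƛ⁺ (·₂⁺ _ [ ·Iβ₀ (star-⟶₀ d p) ]))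
    simulateC (cutξ₂ {t = t} (icnsξ₂ p)) d e G K = trTᵉ-monoʳ-⟶⁺ d e t G (ƛ⁺ (·₁⁺ _ (simulateL p d _ _ _)))
    simulateC (cutξ₂ {t = t} {l = mu c} {l' = l'} p) d e G K = ·₁⁺ _ (simulateL p d e G K) ⁺◅* trLᵉ-apply d e l' t G K

  ⟦⟧-simulates : ∀ t u → t ⟶t u → ⟦ t ⟧ ⟶⁺ ⟦ u ⟧
  ⟦⟧-simulates t u p = ≡⁺≡ (⟦⟧≡barᵉ t) (simulateBar p 0 tvar) (sym (⟦⟧≡barᵉ u))

-- The ω-fragment

ω-renI : ∀ f A → ωInh A → ωInh (renI f A)
ω-renI f (ivar i) h = tt
ω-renI f (ilam A) h = ω-renI _ A h
ω-renI f (iapp A B) (h , h') = ω-renI f A h , ω-renI f B h'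
ω-renI f (A ⊃ B) (h , h') = ω-renI f A h , ω-renI f B h'
ω-renI f (iall D A) (h , h') = h , ω-renI _ A h'

ω-subI : ∀ σ → (∀ i → ωInh (σ i)) → ∀ A → ωInh A → ωInh (subI σ A)
ω-extSI : ∀ σ → (∀ i → ωInh (σ i)) → ∀ i → ωInh (extSI σ i)
ω-extSI σ hσ zero = tt
ω-extSI σ hσ (suc i) = ω-renI suc (σ i) (hσ i)
ω-subI σ hσ (ivar i) h = hσ i
ω-subI σ hσ (ilam A) h = ω-subI _ (ω-extSI σ hσ) A h
ω-subI σ hσ (iapp A B) (h , h') = ω-subI σ hσ A h , ω-subI σ hσ B h'
ω-subI σ hσ (A ⊃ B) (h , h') = ω-subI σ hσ A h , ω-subI σ hσ B h'
ω-subI σ hσ (iall D A) (h , h') = h , ω-subI _ (ω-extSI σ hσ) A h'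

ω-•I : ∀ B → ωInh B → ∀ i → ωInh ((B •I) i)
ω-•I B h zero = h
ω-•I B h (suc i) = tt

ω-⟶₀ : ∀ {A A'} → ωInh A → A ⟶₀ A' → ωInh A'
ω-⟶₀ {iapp (ilam A) B} (h , h') β₀ = ω-subI (B •I) (ω-•I B h') A h
ω-⟶₀ h (ilamξ p) = ω-⟶₀ h p
ω-⟶₀ (h , h') (iappl p) = ω-⟶₀ h p , h'
ω-⟶₀ (h , h') (iappr p) = h , ω-⟶₀ h' p
ω-⟶₀ (h , h') (impl p) = ω-⟶₀ h p , h'
ω-⟶₀ (h , h') (impr p) = h , ω-⟶₀ h' p
ω-⟶₀ (h , h') (iallξ p) = h , ω-⟶₀ h' p

ω-renT : ∀ f X → ωT X → ωT (renT f X)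
ω-renT f (tvar x) h = tt
ω-renT f (ƛ X) h = ω-renT _ X h
ω-renT f (X · Y) (h , h') = ω-renT f X h , ω-renT f Y h'
ω-renT f (Λ X) h = ω-renT f X h
ω-renT f (X ·I A) (h , h') = ω-renT f X h , h'

ω-renIT : ∀ f X → ωT X → ωT (renIT f X)
ω-renIT f (tvar x) h = tt
ω-renIT f (ƛ X) h = ω-renIT f X h
ω-renIT f (X · Y) (h , h') = ω-renIT f X h , ω-renIT f Y h'
ω-renIT f (Λ X) h = ω-renIT _ X h
ω-renIT f (X ·I A) (h , h') = ω-renIT f X h , ω-renI f A h'

ω-wk : ∀ {σ : ℕ → TTm} → (∀ i → ωT (σ i)) → ∀ i → ωT (renT suc (σ i))
ω-wk {σ} h i = ω-renT suc (σ i) (h i)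

ω-extST : ∀ {σ} → (∀ i → ωT (σ i)) → ∀ i → ωT (extST σ i)
ω-extST h zero    = tt
ω-extST {σ} h (suc i) = ω-wk {σ} h i

ω-subT : ∀ σ → (∀ i → ωT (σ i)) → ∀ X → ωT X → ωT (subT σ X)
ω-subT σ hσ (tvar x) h = hσ x
ω-subT σ hσ (ƛ X) h = ω-subT _ (ω-extST {σ} hσ) X h
ω-subT σ hσ (X · Y) (h , h') = ω-subT σ hσ X h , ω-subT σ hσ Y h'
ω-subT σ hσ (Λ X) h = ω-subT _ (λ i → ω-renIT suc (σ i) (hσ i)) X h
ω-subT σ hσ (X ·I A) (h , h') = ω-subT σ hσ X h , h'

ω-subIT : ∀ τ → (∀ i → ωInh (τ i)) → ∀ X → ωT X → ωT (subIT τ X)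
ω-subIT τ hτ (tvar x) h = tt
ω-subIT τ hτ (ƛ X) h = ω-subIT τ hτ X h
ω-subIT τ hτ (X · Y) (h , h') = ω-subIT τ hτ X h , ω-subIT τ hτ Y h'
ω-subIT τ hτ (Λ X) h = ω-subIT _ (ω-extSI τ hτ) X h
ω-subIT τ hτ (X ·I A) (h , h') = ω-subIT τ hτ X h , ω-subI τ hτ A h'

ω-•T : ∀ u → ωT u → ∀ i → ωT ((u •T) i)
ω-•T u h zero = h
ω-•T u h (suc i) = tt

ω-⟶ : ∀ {X Y} → ωT X → X ⟶ Y → ωT Y
ω-⟶ {ƛ t · u} (h , h') β = ω-subT (u •T) (ω-•T u h') t h
ω-⟶ {Λ t ·I B} (h , h') βΛ = ω-subIT (B •I) (ω-•I B h') t h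
ω-⟶ (h , h') (·Iβ₀ p) = h , ω-⟶₀ h' p
ω-⟶ h (ƛξ p) = ω-⟶ h p
ω-⟶ (h , h') (·ξ₁ p) = ω-⟶ h p , h'
ω-⟶ (h , h') (·ξ₂ p) = h , ω-⟶ h' p
ω-⟶ h (Λξ p) = ω-⟶ h p
ω-⟶ (h , h') (·Iξ p) = ω-⟶ h p , h'

⟶⁺⇒⟶ω⁺ : ∀ {X Y} → ωT X → X ⟶⁺ Y → X ⟶ω⁺ Y
⟶⁺⇒⟶ω⁺ h [ p ] = [ h , ω-⟶ h p , p ]
⟶⁺⇒⟶ω⁺ h (p ∷ q) = (h , ω-⟶ h p , p) ∷ ⟶⁺⇒⟶ω⁺ (ω-⟶ h p) q

module CGPS-ω (b : ℕ) (top : Inh) (s : TTm) (ω-top : ωInh top) (ω-s : ωT s) where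
  open CGPS b top s
  open CGPSᵉ b top s

  ω-star : ∀ d A → ωInh A → ωInh (star d A)
  ω-ibar : ∀ d A → ωInh A → ωInh (ibar d A)
  ω-star d (ivar i) h = tt
  ω-star d (ilam A) h = ω-star (suc d) A h
  ω-star d (iapp A B) (h , h') = ω-star d A h , ω-star d B h'
  ω-star d (A ⊃ B) (h , h') = (ω-ibar d B h' , tt) , (ω-ibar d A h , tt)
  ω-star d (iall D A) (h , h') = h , ω-ibar (suc d) A h'
  ω-ibar d A h = ω-renI (d +_) top ω-top , ((ω-star d A h , tt) , tt)

  mutual
    ω-trTᵉ : ∀ d e → (∀ i → ωT (e i)) → ∀ t G K → ωTm t → ωT G → ωT K → ωT (trTᵉ d e t G K)
    ω-trTᵉ d e he (var x) G K ht hG hK = (he x , (ω-s , hG)) , hK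
    ω-trTᵉ d e he (lam t) G K ht hG hK =
      (ω-renT suc K hK , (tt , ω-barᵉ d _ (ω-extST {λ i → wk2 (e i)} (ω-wk {λ i → wk (e i)} (ω-wk {e} he))) t ht)) , hG
    ω-trTᵉ d e he (Lam t) G K ht hG hK =
      (ω-renT suc K hK , ω-barᵉ (suc d) _ (λ i → ω-renIT suc (wk (e i)) (ω-wk {e} he i)) t ht) , hG
    ω-trTᵉ d e he (br c) G K ht hG hK = ω-trCᵉ d e he c _ K ht (ω-s , hG) hK

    ω-trLᵉ : ∀ d e → (∀ i → ωT (e i)) → ∀ l G K → ωCo l → ωT G → ωT K → ωT (trLᵉ d e l G K)
    ω-trLᵉ d e he nil G K hl hG hK = (tt , ω-renT suc G hG) , ω-renT suc K hK
    ω-trLᵉ d e he (cons u l) G K (hu , hl) hG hK =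
      (tt , ω-renT suc G hG) ,
      ((tt , ω-trLᵉ d _ (ω-wk {λ i → wk (e i)} (ω-wk {e} he)) l _ _ hl (ω-renT suc (wk G) (ω-renT suc G hG)) (ω-renT suc (wk K) (ω-renT suc K hK)))
       , ω-barᵉ d _ (ω-wk {λ i → wk (e i)} (ω-wk {e} he)) u hu)
    ω-trLᵉ d e he (icns B l) G K (hB , hl) hG hK =
      (tt , ω-renT suc G hG) ,
      (ω-trLᵉ d _ (ω-wk {λ i → wk (e i)} (ω-wk {e} he)) l _ _ hl (ω-renT suc (wk G) (ω-renT suc G hG)) (ω-renT suc (wk K) (ω-renT suc K hK))
       , (tt , ω-star d B hB))
    ω-trLᵉ d e he (mu c) G K hc hG hK = ω-trCᵉ d _ (ω-extST {e} he) c _ _ hc (ω-renT suc G hG) (ω-renT suc K hK)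

    ω-trCᵉ : ∀ d e → (∀ i → ωT (e i)) → ∀ c G K → ωCmd c → ωT G → ωT K → ωT (trCᵉ d e c G K)
    ω-trCᵉ d e he (cut t nil) G K (ht , _) hG hK = ω-trTᵉ d e he t G K ht hG hK
    ω-trCᵉ d e he (cut t (cons u l)) G K (ht , (hu , hl)) hG hK =
      ω-trTᵉ d e he t G _ ht hG
        ((tt , ω-trLᵉ d _ (ω-wk {e} he) l _ _ hl (ω-renT suc G hG) (ω-renT suc K hK)) , ω-barᵉ d _ (ω-wk {e} he) u hu)
    ω-trCᵉ d e he (cut t (icns B l)) G K (ht , (hB , hl)) hG hK =
      ω-trTᵉ d e he t G _ ht hG
        (ω-trLᵉ d _ (ω-wk {e} he) l _ _ hl (ω-renT suc G hG) (ω-renT suc K hK) , (tt , ω-star d B hB))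
    ω-trCᵉ d e he (cut t (mu c)) G K (ht , hc) hG hK =
      ω-trLᵉ d e he (mu c) G K hc hG hK , ω-barᵉ d e he t ht

    ω-barᵉ : ∀ d e → (∀ i → ωT (e i)) → ∀ t → ωTm t → ωT (barᵉ d e t)
    ω-barᵉ d e he t ht = ω-trTᵉ d _ (ω-wk {λ i → wk (e i)} (ω-wk {e} he)) t _ _ ht tt tt

  ω-⟦⟧ : ∀ t → ωTm t → ωT ⟦ t ⟧
  ω-⟦⟧ t h = subst ωT (sym (⟦⟧≡barᵉ t)) (ω-barᵉ 0 tvar (λ _ → tt) t h)

theorem5p7 : (b : ℕ) (top : Inh) (s : TTm)
    → ClosedT s
    → (∀ G → s · G ⟶⁺ G)
    → ((t u : Tm) → t ⟶t u → CGPS.⟦_⟧ b top s t ⟶⁺ CGPS.⟦_⟧ b top s u)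
    × (ωInh top → ωT s → (∀ G → ωT G → s · G ⟶ω⁺ G)
    → (t u : Tm) → t ⟶tω u
    → CGPS.⟦_⟧ b top s t ⟶ω⁺ CGPS.⟦_⟧ b top s u)
theorem5p7 b top s s-closed s-step =
  ⟦⟧-simulates ,
  λ ω-top ω-s _ t u (ω-t , _ , t⟶u) → ⟶⁺⇒⟶ω⁺ (CGPS-ω.ω-⟦⟧ b top s ω-top ω-s t ω-t) (⟦⟧-simulates t u t⟶u)
  where open CGPS-Simulation b top s s-closed s-step using (⟦⟧-simulates)
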